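{- Let $D\in\mathcal{F}_n$, let $Q\in\Gamma(D)$, and let $C$ be the oriented graph with $S(C)=Q^TS(D)Q$. Then $\ell(Q)$ divides both $d_n(W(D))$ and $d_n(W(C))$. Moreover, $C\in\mathcal{F}_n$.
   Context: An oriented graph on vertices $v_1,\dots,v_n$ is a digraph obtained from a simple undirected graph by orienting each edge. Its skew-adjacency matrix $S(D)=(s_{ij})$ has $s_{ij}=1$ if $(v_i,v_j)$ is an arc, $s_{ij}=-1$ if $(v_j,v_i)$ is an arc, and $0$ otherwise. Let $e$ be the all-ones vector of length $n$. The skew-walk matrix is $W(D)=[e,S(D)e,\dots,S(D)^{n-1}e]$. $\mathcal{F}_n$ is the set of oriented graphs $D$ of order $n$ such that $2^{ -\lfloor n/2\rfloor}\det W(D)$ is an odd square-free integer. $\Gamma(D)$ is the set of all $n\times n$ orthogonal matrices $Q$ with rational entries such that $Qe=e$ and $Q^TS(D)Q=S(C)$ for some oriented graph $C$. For a rational orthogonal matrix $Q$, its level $\ell(Q)$ is the smallest positive integer $x$ such that $xQ$ is an integral matrix. For a nonsingular integral $n\times n$ matrix $M$, $d_n(M)$ denotes its $n$-th (largest) invariant factor, i.e. the last diagonal entry of its Smith normal form $\mathrm{diag}(d_1,\dots,d_n)$ with $d_i\mid d_{i+1}$. -}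

module Defs where

open import Data.Bool using (Bool; true; false; if_then_else_)
open import Data.Nat as ℕ using (ℕ; zero; suc; ⌊_/2⌋)
open import Data.Nat.Divisibility as ℕD using ()
open import Data.Integer as ℤ using (ℤ; +_; ∣_∣)
open import Data.Rational as ℚ using (ℚ; 0ℚ; 1ℚ)
open import Data.Fin using (Fin; zero; suc; punchIn; inject₁; fromℕ)
open import Data.Product using (Σ; ∃; _×_; _,_)
open import Data.Sum using (_⊎_)
open import Relation.Binary.PropositionalEquality using (_≡_)
open import Relation.Nullary using (¬_)

Mat : Set → ℕ → Set
Mat A n = Fin n → Fin n → A

sumWith : {A : Set} → (A → A → A) → A → {n : ℕ} → (Fin n → A) → A
sumWith _+_ z {zero}  f = z
sumWith _+_ z {suc n} f = f zero + sumWith _+_ z (λ i → f (suc i))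

Σℤ : {n : ℕ} → (Fin n → ℤ) → ℤ
Σℤ = sumWith ℤ._+_ (+ 0)

Σℚ : {n : ℕ} → (Fin n → ℚ) → ℚ
Σℚ = sumWith ℚ._+_ 0ℚ

_*ᴹ_ : {n : ℕ} → Mat ℤ n → Mat ℤ n → Mat ℤ n
(A *ᴹ B) i j = Σℤ (λ k → A i k ℤ.* B k j)

idℤ : {n : ℕ} → Mat ℤ n
idℤ i j with i Data.Fin.≟ j
... | Relation.Nullary.yes _ = + 1
... | Relation.Nullary.no _  = + 0
  where open import Data.Fin using (_≟_)

_^ᴹ_ : {n : ℕ} → Mat ℤ n → ℕ → Mat ℤ n
A ^ᴹ zero  = idℤ
A ^ᴹ suc k = A *ᴹ (A ^ᴹ k)

_·ᵥ_ : {n : ℕ} → Mat ℤ n → (Fin n → ℤ) → (Fin n → ℤ)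
(A ·ᵥ v) i = Σℤ (λ k → A i k ℤ.* v k)

sgn : {n : ℕ} → Fin n → ℤ
sgn zero          = + 1
sgn (suc zero)    = ℤ.- (+ 1)
sgn (suc (suc i)) = sgn i

det : {n : ℕ} → Mat ℤ n → ℤ
det {zero}  M = + 1
det {suc n} M = Σℤ (λ j → sgn j ℤ.* (M zero j ℤ.* det (λ r c → M (suc r) (punchIn j c))))

_*ᴿ_ : {n : ℕ} → Mat ℚ n → Mat ℚ n → Mat ℚ n
(A *ᴿ B) i j = Σℚ (λ k → A i k ℚ.* B k j)

transpose : {A : Set} {n : ℕ} → Mat A n → Mat A n
transpose M i j = M j i

toℚᴹ : {n : ℕ} → Mat ℤ n → Mat ℚ n
toℚᴹ M i j = M i j ℚ./ 1

-- Q is orthogonal: Qᵀ Q = I (for square matrices equivalent to Q Qᵀ = I)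
Orthogonal : {n : ℕ} → Mat ℚ n → Set
Orthogonal Q = ∀ i j → (transpose Q *ᴿ Q) i j ≡ toℚᴹ idℤ i j

FixesOnes : {n : ℕ} → Mat ℚ n → Set
FixesOnes Q = ∀ i → Σℚ (λ k → Q i k) ≡ 1ℚ

ScaledIntegral : {n : ℕ} → ℕ → Mat ℚ n → Set
ScaledIntegral x Q = ∀ i j → ∃ λ (z : ℤ) → ((+ x) ℚ./ 1) ℚ.* Q i j ≡ z ℚ./ 1

IsLevel : {n : ℕ} → Mat ℚ n → ℕ → Set
IsLevel Q ℓ = (1 ℕ.≤ ℓ) × ScaledIntegral ℓ Q
            × (∀ x → 1 ℕ.≤ x → ScaledIntegral x Q → ℓ ℕ.≤ x)

record OrientedGraph (n : ℕ) : Set where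
  field
    arc     : Fin n → Fin n → Bool
    irrefl  : ∀ i → arc i i ≡ false
    asym    : ∀ i j → arc i j ≡ true → arc j i ≡ false
open OrientedGraph public

S : {n : ℕ} → OrientedGraph n → Mat ℤ n
S D i j = if arc D i j then + 1 else (if arc D j i then ℤ.- (+ 1) else + 0)

ones : {n : ℕ} → Fin n → ℤ
ones _ = + 1

W : {n : ℕ} → OrientedGraph n → Mat ℤ n
W {n} D i k = ((S D ^ᴹ Data.Fin.toℕ k) ·ᵥ ones) i

Odd : ℤ → Set
Odd m = ¬ (2 ℕD.∣ ∣ m ∣)

SquareFree : ℤ → Set
SquareFree m = ∀ (k : ℕ) → (k ℕ.* k) ℕD.∣ ∣ m ∣ → k ≡ 1

InF : {n : ℕ} → OrientedGraph n → Set
InF {n} D = ∃ λ (m : ℤ) → (det (W D) ≡ (+ (2 ℕ.^ ⌊ n /2⌋)) ℤ.* m) × Odd m × SquareFree m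

Unimodular : {n : ℕ} → Mat ℤ n → Set
Unimodular U = (det U ≡ + 1) ⊎ (det U ≡ ℤ.- (+ 1))

diag : {n : ℕ} → (Fin n → ℤ) → Mat ℤ n
diag d i j = idℤ i j ℤ.* d i

IsSNF : {n : ℕ} → Mat ℤ n → (Fin n → ℤ) → Set
IsSNF {n} M d =
  (∃ λ (U : Mat ℤ n) → ∃ λ (V : Mat ℤ n) →
     Unimodular U × Unimodular V × (∀ i j → ((U *ᴹ M) *ᴹ V) i j ≡ diag d i j))
  × (∀ i → + 0 ℤ.≤ d i)
  × (∀ (i : Fin n) (j : Fin n) → Data.Fin.toℕ j ≡ suc (Data.Fin.toℕ i) → ∣ d i ∣ ℕD.∣ ∣ d j ∣)

DividesLastInvFactor : {m : ℕ} → ℕ → Mat ℤ (suc m) → Set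
DividesLastInvFactor {m} ℓ M = ∀ d → IsSNF M d → ℓ ℕD.∣ ∣ d (fromℕ m) ∣

-- Let P = ℓQ, an integral matrix. From QᵀQ = I, Qᵀ S(D) Q = S(C) and Qe = e we get PᵀP = ℓ²I,
-- Pᵀ S(D) P = ℓ² S(C) and Pe = ℓe. Over ℤ the adjugate upgrades PᵀP = ℓ²I to PPᵀ = ℓ²I, hence
-- Pᵀ S(D) = S(C) Pᵀ, S(D) P = P S(C) and Pᵀe = ℓe, and therefore Pᵀ W(D) = ℓ W(C) and
-- P W(C) = ℓ W(D).
-- If U W(D) V = diag(d) is the Smith normal form, then W(D) · V diag(dₙ/dᵢ) U = dₙ I, so
-- dₙ Pᵀ = ℓ K with K integral: dₙ Q is integral, and ℓ ∣ dₙ by minimality of the level.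
-- The same argument with P W(C) = ℓ W(D) gives ℓ ∣ dₙ(W(C)). Finally (det P)² = det (PᵀP) = ℓ²ⁿ,
-- so det P = ±ℓⁿ and det W(C) = ± det W(D); membership in 𝓕ₙ only depends on |det W|.
-- Multiplicativity of det comes from the first-row Laplace expansion: det is multilinear and
-- alternating in the rows, and such a form that vanishes at I vanishes identically.

{-# OPTIONS --safe #-}
module Submission where

open import Defs
open import Algebra.Bundles using (CommutativeMonoid; Semiring; Ring)
import Algebra.Properties.AbelianGroup
import Algebra.Properties.CommutativeSemigroup
import Algebra.Properties.Semiring.Sum
open import Data.Empty using (⊥-elim)
open import Data.Fin as F using (Fin; zero; suc; punchIn; toℕ; fromℕ; fromℕ<)
import Data.Fin.Induction as FInd
import Data.Fin.Properties as FP
open import Data.Integer as ℤ using (ℤ; +_; -_; _+_; _*_; _-_; _^_; ∣_∣)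
import Data.Integer.Properties as ℤP
open import Data.Integer.Solver using (module +-*-Solver)
open import Data.Nat as ℕ using (ℕ; zero; suc; ⌊_/2⌋)
import Data.Nat.Divisibility as ℕD
import Data.Nat.DivMod as ℕDM
import Data.Nat.Induction as ℕInd
import Data.Nat.Properties as ℕP
open import Data.Product using (∃; _,_; proj₁; proj₂; _×_)
open import Data.Rational as ℚ using (ℚ; 0ℚ; 1ℚ)
import Data.Rational.Properties as ℚP
open import Data.Rational.Unnormalised as ℚᵘ using (mkℚᵘ; *≡*)
import Data.Rational.Unnormalised.Properties as ℚᵘP
open import Data.Sum using (_⊎_; inj₁; inj₂)
open import Data.Vec.Functional using (updateAt)
import Data.Vec.Functional.Properties as VecP
open import Function using (_∘_; const; id)
open import Induction.WellFounded using (module All)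
import Level
open import Relation.Binary.Bundles using (Setoid)
import Relation.Binary.Construct.On as On
open import Relation.Binary.PropositionalEquality
import Relation.Binary.Reasoning.Setoid as SetoidReasoning
open import Relation.Nullary using (¬_; yes; no; Dec)

open +-*-Solver

private
  variable
    k m n : ℕ

-- Finite sums and integer arithmetic

sumWith≡sum : ∀ {ℓ} (R : Semiring Level.0ℓ ℓ) (f : Fin n → Semiring.Carrier R) →
              sumWith (Semiring._+_ R) (Semiring.0# R) f ≡ Algebra.Properties.Semiring.Sum.sum R f
sumWith≡sum {zero}  R f = refl
sumWith≡sum {suc n} R f = cong (Semiring._+_ R (f zero)) (sumWith≡sum R (f ∘ suc))

module ℤΣ = Algebra.Properties.Semiring.Sum ℤP.+-*-semiring
module ℚΣ = Algebra.Properties.Semiring.Sum (Ring.semiring ℚP.+-*-ring)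
module ℤ+ = Algebra.Properties.AbelianGroup ℤP.+-0-abelianGroup
module ℚ* = Algebra.Properties.CommutativeSemigroup
               (CommutativeMonoid.commutativeSemigroup ℚP.*-1-commutativeMonoid)
open Algebra.Properties.CommutativeSemigroup ℤP.*-commutativeSemigroup using (x∙yz≈y∙xz; interchange)

Σℤ≡sum : (f : Fin n → ℤ) → Σℤ f ≡ ℤΣ.sum f
Σℤ≡sum = sumWith≡sum ℤP.+-*-semiring

Σℤ-cong : {f g : Fin n → ℤ} → (∀ i → f i ≡ g i) → Σℤ f ≡ Σℤ g
Σℤ-cong {zero}  h = refl
Σℤ-cong {suc n} h = cong₂ _+_ (h zero) (Σℤ-cong (h ∘ suc))

Σℤ-zero : {f : Fin n → ℤ} → (∀ i → f i ≡ + 0) → Σℤ f ≡ + 0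
Σℤ-zero {n} h = trans (Σℤ-cong h) (trans (Σℤ≡sum {n} (λ _ → + 0)) (ℤΣ.sum-replicate-zero n))

Σℤ-distrib-+ : (f g : Fin n → ℤ) → Σℤ (λ i → f i + g i) ≡ Σℤ f + Σℤ g
Σℤ-distrib-+ f g = trans (Σℤ≡sum (λ i → f i + g i))
  (trans (ℤΣ.∑-distrib-+ f g) (sym (cong₂ _+_ (Σℤ≡sum f) (Σℤ≡sum g))))

*-distribˡ-Σℤ : (c : ℤ) (f : Fin n → ℤ) → c * Σℤ f ≡ Σℤ (λ i → c * f i)
*-distribˡ-Σℤ c f = trans (cong (c *_) (Σℤ≡sum f))
  (trans (ℤΣ.*-distribˡ-sum c f) (sym (Σℤ≡sum (λ i → c * f i))))

*-distribʳ-Σℤ : (c : ℤ) (f : Fin n → ℤ) → Σℤ f * c ≡ Σℤ (λ i → f i * c)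
*-distribʳ-Σℤ c f = trans (cong (_* c) (Σℤ≡sum f))
  (trans (ℤΣ.*-distribʳ-sum c f) (sym (Σℤ≡sum (λ i → f i * c))))

Σℤ-linear : (a b : ℤ) (f g : Fin n → ℤ) →
            Σℤ (λ i → a * f i + b * g i) ≡ a * Σℤ f + b * Σℤ g
Σℤ-linear a b f g = trans (Σℤ-distrib-+ (λ i → a * f i) (λ i → b * g i))
  (sym (cong₂ _+_ (*-distribˡ-Σℤ a f) (*-distribˡ-Σℤ b g)))

neg-distrib-Σℤ : (f : Fin n → ℤ) → - Σℤ f ≡ Σℤ (λ i → - f i)
neg-distrib-Σℤ f = trans (sym (ℤP.-1*i≡-i (Σℤ f)))
  (trans (*-distribˡ-Σℤ ℤ.-1ℤ f) (Σℤ-cong (ℤP.-1*i≡-i ∘ f)))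

Σℤ-comm : (f : Fin m → Fin n → ℤ) →
          Σℤ (λ i → Σℤ (f i)) ≡ Σℤ (λ j → Σℤ (λ i → f i j))
Σℤ-comm f = begin
  Σℤ (λ i → Σℤ (f i))                ≡⟨ Σℤ-cong (λ i → Σℤ≡sum (f i)) ⟩
  Σℤ (λ i → ℤΣ.sum (f i))            ≡⟨ Σℤ≡sum (λ i → ℤΣ.sum (f i)) ⟩
  ℤΣ.sum (λ i → ℤΣ.sum (f i))        ≡⟨ ℤΣ.∑-comm f ⟩
  ℤΣ.sum (λ j → ℤΣ.sum (λ i → f i j)) ≡⟨ sym (Σℤ≡sum (λ j → ℤΣ.sum (λ i → f i j))) ⟩
  Σℤ (λ j → ℤΣ.sum (λ i → f i j))     ≡⟨ sym (Σℤ-cong (λ j → Σℤ≡sum (λ i → f i j))) ⟩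
  Σℤ (λ j → Σℤ (λ i → f i j))        ∎
  where open ≡-Reasoning

Σℤ-select : (f : Fin n → ℤ) (j : Fin n) → (∀ i → i ≢ j → f i ≡ + 0) → Σℤ f ≡ f j
Σℤ-select f zero    h = trans (cong (λ s → f zero + s) (Σℤ-zero (λ i → h (suc i) λ ()))) (ℤP.+-identityʳ _)
Σℤ-select f (suc j) h = trans (cong₂ _+_ (h zero λ ()) (Σℤ-select (f ∘ suc) j h′)) (ℤP.+-identityˡ _)
  where
  h′ : ∀ i → i ≢ j → f (suc i) ≡ + 0
  h′ i i≢j = h (suc i) (i≢j ∘ FP.suc-injective)

*-cancelˡ-≢0 : ∀ {a b} c → c ≢ + 0 → c * a ≡ c * b → a ≡ b
*-cancelˡ-≢0 {a} {b} c c≢0 = ℤP.*-cancelˡ-≡ c a b {{ℤ.≢-nonZero c≢0}}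

*-≢0 : ∀ {a b} → a ≢ + 0 → b ≢ + 0 → a * b ≢ + 0
*-≢0 {a} a≢0 b≢0 ab≡0 with ℤP.i*j≡0⇒i≡0∨j≡0 a ab≡0
... | inj₁ a≡0 = a≢0 a≡0
... | inj₂ b≡0 = b≢0 b≡0

i≡-i⇒i≡0 : ∀ i → i ≡ - i → i ≡ + 0
i≡-i⇒i≡0 i i≡-i = *-cancelˡ-≢0 (+ 2) (λ ()) (begin
  + 2 * i   ≡⟨ solve 1 (λ x → con (+ 2) :* x := x :+ x) refl i ⟩
  i + i     ≡⟨ cong (λ t → i + t) i≡-i ⟩
  i + - i   ≡⟨ ℤP.+-inverseʳ i ⟩
  + 0       ≡⟨ sym (ℤP.*-zeroʳ (+ 2)) ⟩
  + 2 * + 0 ∎)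
  where open ≡-Reasoning

i*i≡j*j⇒i≡±j : ∀ i j → i * i ≡ j * j → i ≡ j ⊎ i ≡ - j
i*i≡j*j⇒i≡±j i j eq with ℤP.i*j≡0⇒i≡0∨j≡0 (i - j) difference-of-squares
  where
  difference-of-squares : (i - j) * (i + j) ≡ + 0
  difference-of-squares = trans (solve 2 (λ i j → (i :- j) :* (i :+ j) := i :* i :- j :* j) refl i j)
                                (trans (cong (_- j * j) eq) (ℤP.+-inverseʳ (j * j)))
... | inj₁ i-j≡0 = inj₁ (ℤP.i-j≡0⇒i≡j i j i-j≡0)
... | inj₂ i+j≡0 = inj₂ (ℤP.i-j≡0⇒i≡j i (- j) (trans (cong (λ t → i + t) (ℤP.neg-involutive j)) i+j≡0))

^-distrib-* : (a b : ℤ) (n : ℕ) → (a * b) ^ n ≡ a ^ n * b ^ n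
^-distrib-* a b zero    = refl
^-distrib-* a b (suc n) = trans (cong (a * b *_) (^-distrib-* a b n)) (interchange a b (a ^ n) (b ^ n))

-- Integer matrices

infix 4 _≈ᴹ_
_≈ᴹ_ : Mat ℤ n → Mat ℤ n → Set
A ≈ᴹ B = ∀ i j → A i j ≡ B i j

≈ᴹ-refl : {A : Mat ℤ n} → A ≈ᴹ A
≈ᴹ-refl i j = refl

≈ᴹ-sym : {A B : Mat ℤ n} → A ≈ᴹ B → B ≈ᴹ A
≈ᴹ-sym A≈B i j = sym (A≈B i j)

≈ᴹ-trans : {A B C : Mat ℤ n} → A ≈ᴹ B → B ≈ᴹ C → A ≈ᴹ C
≈ᴹ-trans A≈B B≈C i j = trans (A≈B i j) (B≈C i j)

≈ᴹ-setoid : ℕ → Setoid _ _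
≈ᴹ-setoid n = record
  { Carrier       = Mat ℤ n
  ; _≈_           = _≈ᴹ_
  ; isEquivalence = record { refl = ≈ᴹ-refl ; sym = ≈ᴹ-sym ; trans = ≈ᴹ-trans }
  }

module ≈ᴹ-Reasoning {n} = SetoidReasoning (≈ᴹ-setoid n)

_*ₗ_ : ℤ → Mat ℤ n → Mat ℤ n
(c *ₗ A) i j = c * A i j

idℤ-diag : (i : Fin n) → idℤ i i ≡ + 1
idℤ-diag i with i F.≟ i
... | yes _   = refl
... | no  i≢i = ⊥-elim (i≢i refl)

idℤ-off : {i j : Fin n} → i ≢ j → idℤ i j ≡ + 0
idℤ-off {i = i} {j} i≢j with i F.≟ j
... | yes i≡j = ⊥-elim (i≢j i≡j)
... | no  _   = refl

idℤ-sym : (i j : Fin n) → idℤ i j ≡ idℤ j i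
idℤ-sym i j = by-cases (i F.≟ j)
  where
  by-cases : Dec (i ≡ j) → idℤ i j ≡ idℤ j i
  by-cases (yes refl) = refl
  by-cases (no i≢j)   = trans (idℤ-off i≢j) (sym (idℤ-off (i≢j ∘ sym)))

idℤ-suc : (i j : Fin n) → idℤ (suc i) (suc j) ≡ idℤ i j
idℤ-suc i j = by-cases (i F.≟ j)
  where
  by-cases : Dec (i ≡ j) → idℤ (suc i) (suc j) ≡ idℤ i j
  by-cases (yes refl) = trans (idℤ-diag (suc i)) (sym (idℤ-diag i))
  by-cases (no i≢j)   = trans (idℤ-off (i≢j ∘ FP.suc-injective)) (sym (idℤ-off i≢j))

Σℤ-*idℤ : (f : Fin n → ℤ) (j : Fin n) → Σℤ (λ k → f k * idℤ k j) ≡ f j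
Σℤ-*idℤ f j = trans (Σℤ-select (λ k → f k * idℤ k j) j off-diagonal)
                    (trans (cong (f j *_) (idℤ-diag j)) (ℤP.*-identityʳ (f j)))
  where
  off-diagonal : ∀ k → k ≢ j → f k * idℤ k j ≡ + 0
  off-diagonal k k≢j = trans (cong (f k *_) (idℤ-off k≢j)) (ℤP.*-zeroʳ (f k))

Σℤ-idℤ* : (f : Fin n → ℤ) (j : Fin n) → Σℤ (λ k → idℤ j k * f k) ≡ f j
Σℤ-idℤ* f j = trans (Σℤ-cong (λ k → trans (ℤP.*-comm (idℤ j k) (f k)) (cong (f k *_) (idℤ-sym j k))))
                    (Σℤ-*idℤ f j)

*ᴹ-cong : {A A′ B B′ : Mat ℤ n} → A ≈ᴹ A′ → B ≈ᴹ B′ → (A *ᴹ B) ≈ᴹ (A′ *ᴹ B′)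
*ᴹ-cong A≈A′ B≈B′ i j = Σℤ-cong (λ k → cong₂ _*_ (A≈A′ i k) (B≈B′ k j))

*ᴹ-congˡ : (A : Mat ℤ n) {B B′ : Mat ℤ n} → B ≈ᴹ B′ → (A *ᴹ B) ≈ᴹ (A *ᴹ B′)
*ᴹ-congˡ A = *ᴹ-cong {A = A} ≈ᴹ-refl

*ᴹ-congʳ : (B : Mat ℤ n) {A A′ : Mat ℤ n} → A ≈ᴹ A′ → (A *ᴹ B) ≈ᴹ (A′ *ᴹ B)
*ᴹ-congʳ B A≈A′ = *ᴹ-cong {B = B} A≈A′ ≈ᴹ-refl

*ᴹ-assoc : (A B C : Mat ℤ n) → ((A *ᴹ B) *ᴹ C) ≈ᴹ (A *ᴹ (B *ᴹ C))
*ᴹ-assoc A B C i j = begin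
  Σℤ (λ k → Σℤ (λ l → A i l * B l k) * C k j)
    ≡⟨ Σℤ-cong (λ k → *-distribʳ-Σℤ (C k j) (λ l → A i l * B l k)) ⟩
  Σℤ (λ k → Σℤ (λ l → A i l * B l k * C k j))
    ≡⟨ Σℤ-comm (λ k l → A i l * B l k * C k j) ⟩
  Σℤ (λ l → Σℤ (λ k → A i l * B l k * C k j))
    ≡⟨ Σℤ-cong (λ l → trans (Σℤ-cong (λ k → ℤP.*-assoc (A i l) (B l k) (C k j)))
                            (sym (*-distribˡ-Σℤ (A i l) (λ k → B l k * C k j)))) ⟩
  Σℤ (λ l → A i l * Σℤ (λ k → B l k * C k j)) ∎
  where open ≡-Reasoning

*ᴹ-identityˡ : (A : Mat ℤ n) → (idℤ *ᴹ A) ≈ᴹ A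
*ᴹ-identityˡ A i j = Σℤ-idℤ* (λ k → A k j) i

*ᴹ-identityʳ : (A : Mat ℤ n) → (A *ᴹ idℤ) ≈ᴹ A
*ᴹ-identityʳ A i j = Σℤ-*idℤ (A i) j

*ₗ-cong : (c : ℤ) {A B : Mat ℤ n} → A ≈ᴹ B → (c *ₗ A) ≈ᴹ (c *ₗ B)
*ₗ-cong c A≈B i j = cong (c *_) (A≈B i j)

*ₗ-assoc : (c d : ℤ) (A : Mat ℤ n) → (c *ₗ (d *ₗ A)) ≈ᴹ ((c * d) *ₗ A)
*ₗ-assoc c d A i j = sym (ℤP.*-assoc c d (A i j))

*ₗ-cancel : (c : ℤ) {A B : Mat ℤ n} → c ≢ + 0 → (c *ₗ A) ≈ᴹ (c *ₗ B) → A ≈ᴹ B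
*ₗ-cancel c c≢0 cA≈cB i j = *-cancelˡ-≢0 c c≢0 (cA≈cB i j)

*ₗ-*ᴹ : (c : ℤ) (A B : Mat ℤ n) → ((c *ₗ A) *ᴹ B) ≈ᴹ (c *ₗ (A *ᴹ B))
*ₗ-*ᴹ c A B i j = trans (Σℤ-cong (λ k → ℤP.*-assoc c (A i k) (B k j)))
                        (sym (*-distribˡ-Σℤ c (λ k → A i k * B k j)))

*ᴹ-*ₗ : (c : ℤ) (A B : Mat ℤ n) → (A *ᴹ (c *ₗ B)) ≈ᴹ (c *ₗ (A *ᴹ B))
*ᴹ-*ₗ c A B i j = trans (Σℤ-cong (λ k → x∙yz≈y∙xz (A i k) c (B k j)))
                        (sym (*-distribˡ-Σℤ c (λ k → A i k * B k j)))

*ₗidℤ-*ᴹ : (c : ℤ) (B : Mat ℤ n) → ((c *ₗ idℤ) *ᴹ B) ≈ᴹ (c *ₗ B)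
*ₗidℤ-*ᴹ c B = ≈ᴹ-trans (*ₗ-*ᴹ c idℤ B) (*ₗ-cong c (*ᴹ-identityˡ B))

*ᴹ-*ₗidℤ : (c : ℤ) (B : Mat ℤ n) → (B *ᴹ (c *ₗ idℤ)) ≈ᴹ (c *ₗ B)
*ᴹ-*ₗidℤ c B = ≈ᴹ-trans (*ᴹ-*ₗ c B idℤ) (*ₗ-cong c (*ᴹ-identityʳ B))

·ᵥ-*ᴹ : (A B : Mat ℤ n) (v : Fin n → ℤ) (i : Fin n) → (A ·ᵥ (B ·ᵥ v)) i ≡ ((A *ᴹ B) ·ᵥ v) i
·ᵥ-*ᴹ A B v i = begin
  Σℤ (λ k → A i k * Σℤ (λ l → B k l * v l))
    ≡⟨ Σℤ-cong (λ k → trans (*-distribˡ-Σℤ (A i k) (λ l → B k l * v l))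
                            (Σℤ-cong (λ l → sym (ℤP.*-assoc (A i k) (B k l) (v l))))) ⟩
  Σℤ (λ k → Σℤ (λ l → A i k * B k l * v l))
    ≡⟨ Σℤ-comm (λ k l → A i k * B k l * v l) ⟩
  Σℤ (λ l → Σℤ (λ k → A i k * B k l * v l))
    ≡⟨ Σℤ-cong (λ l → sym (*-distribʳ-Σℤ (v l) (λ k → A i k * B k l))) ⟩
  Σℤ (λ l → Σℤ (λ k → A i k * B k l) * v l) ∎
  where open ≡-Reasoning

·ᵥ-cong : {A B : Mat ℤ n} {v w : Fin n → ℤ} → A ≈ᴹ B → (∀ k → v k ≡ w k) →
          ∀ i → (A ·ᵥ v) i ≡ (B ·ᵥ w) i
·ᵥ-cong A≈B v≗w i = Σℤ-cong (λ k → cong₂ _*_ (A≈B i k) (v≗w k))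

·ᵥ-*ₗ : (A : Mat ℤ n) (c : ℤ) (v : Fin n → ℤ) (i : Fin n) →
        (A ·ᵥ (λ k → c * v k)) i ≡ c * (A ·ᵥ v) i
·ᵥ-*ₗ A c v i = trans (Σℤ-cong (λ k → x∙yz≈y∙xz (A i k) c (v k)))
                      (sym (*-distribˡ-Σℤ c (λ k → A i k * v k)))

infix 8 _[_]≔_
_[_]≔_ : {X : Set} → (Fin n → X) → Fin n → X → Fin n → X
xs [ j ]≔ x = updateAt xs j (const x)

[]≔-updates : {X : Set} (xs : Fin n → X) (j : Fin n) (x : X) → (xs [ j ]≔ x) j ≡ x
[]≔-updates xs j x = VecP.updateAt-updates j xs

[]≔-minimal : {X : Set} (xs : Fin n → X) {i j : Fin n} (x : X) → i ≢ j →
              (xs [ j ]≔ x) i ≡ xs i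
[]≔-minimal xs {i} {j} x = VecP.updateAt-minimal i j xs

[]≔-cong : {A B : Fin m → Fin n → ℤ} (j : Fin m) {u v : Fin n → ℤ} →
           (∀ i c → A i c ≡ B i c) → (∀ c → u c ≡ v c) →
           ∀ i c → (A [ j ]≔ u) i c ≡ (B [ j ]≔ v) i c
[]≔-cong zero    A≈B u≗v zero    c = u≗v c
[]≔-cong zero    A≈B u≗v (suc i) c = A≈B (suc i) c
[]≔-cong (suc j) A≈B u≗v zero    c = A≈B zero c
[]≔-cong (suc j) A≈B u≗v (suc i) c = []≔-cong j (A≈B ∘ suc) u≗v i c

[]≔-self : (A : Mat ℤ n) (j : Fin n) → (A [ j ]≔ A j) ≈ᴹ A
[]≔-self A j i c = cong (λ row → row c) (VecP.updateAt-id-local j A refl i)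

[]≔-comm : (A : Mat ℤ n) {i j : Fin n} (u v : Fin n → ℤ) → i ≢ j →
           ((A [ i ]≔ u) [ j ]≔ v) ≈ᴹ ((A [ j ]≔ v) [ i ]≔ u)
[]≔-comm A {i} {j} u v i≢j r c =
  cong (λ row → row c) (VecP.updateAt-commutes j i (i≢j ∘ sym) A r)

minor : Mat ℤ (suc n) → Fin (suc n) → Mat ℤ n
minor A j r c = A (suc r) (punchIn j c)

minor-[]≔ : (A : Mat ℤ (suc (suc n))) (j : Fin (suc n)) (v : Fin (suc (suc n)) → ℤ) (c : Fin (suc (suc n))) →
            minor (A [ suc j ]≔ v) c ≈ᴹ (minor A c [ j ]≔ (v ∘ punchIn c))
minor-[]≔ A j v c r c′ = cong (λ row → row c′)
  (VecP.map-updateAt {f = _∘ punchIn c} {g = const v} (λ _ → refl) (A ∘ suc) j r)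

_ᵛ*ᴹ_ : (Fin n → ℤ) → Mat ℤ n → Fin n → ℤ
(v ᵛ*ᴹ B) c = Σℤ (λ k → v k * B k c)

[]≔-*ᴹ : (A B : Mat ℤ n) (j : Fin n) (v : Fin n → ℤ) →
         ((A [ j ]≔ v) *ᴹ B) ≈ᴹ ((A *ᴹ B) [ j ]≔ (v ᵛ*ᴹ B))
[]≔-*ᴹ A B j v r c = cong (λ row → row c)
  (VecP.map-updateAt {f = λ row → row ᵛ*ᴹ B} {g = const v} (λ _ → refl) A j r)

ᵛ*ᴹ-linear : (a b : ℤ) (u w : Fin n → ℤ) (B : Mat ℤ n) (c : Fin n) →
             ((λ k → a * u k + b * w k) ᵛ*ᴹ B) c ≡ a * (u ᵛ*ᴹ B) c + b * (w ᵛ*ᴹ B) c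
ᵛ*ᴹ-linear a b u w B c = trans
  (Σℤ-cong (λ k → solve 5 (λ a u b w x → (a :* u :+ b :* w) :* x := a :* (u :* x) :+ b :* (w :* x))
                          refl a (u k) b (w k) (B k c)))
  (Σℤ-linear a b (λ k → u k * B k c) (λ k → w k * B k c))

-- Laplace expansion, transposition and exchange of two rows

det-cong : {A B : Mat ℤ n} → A ≈ᴹ B → det A ≡ det B
det-cong {zero}  A≈B = refl
det-cong {suc n} A≈B = Σℤ-cong (λ j → cong₂ (λ a d → sgn j * (a * d)) (A≈B zero j)
                                            (det-cong (λ r c → A≈B (suc r) (punchIn j c))))

sgn-suc : (i : Fin n) → sgn (suc i) ≡ - sgn i
sgn-suc zero    = refl
sgn-suc (suc i) = sym (trans (cong -_ (sgn-suc i)) (ℤP.neg-involutive (sgn i)))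

Σℤ-sgn-comm : (a : Fin m → ℤ) (b : Fin n → ℤ) (x : Fin n → Fin m → ℤ) →
              Σℤ (λ j → sgn (suc j) * (a j * Σℤ (λ i → sgn i * (b i * x i j)))) ≡
              Σℤ (λ i → sgn (suc i) * (b i * Σℤ (λ j → sgn j * (a j * x i j))))
Σℤ-sgn-comm {m = m} {n = n} a b x = begin
  Σℤ (λ j → sgn (suc j) * (a j * Σℤ (λ i → sgn i * (b i * x i j))))
    ≡⟨ Σℤ-cong (λ j → trans (pull (sgn (suc j)) (a j) (λ i → sgn i * (b i * x i j)))
                            (Σℤ-cong (λ i → lhs-term i j))) ⟩
  Σℤ (λ j → Σℤ (λ i → t i j))
    ≡⟨ Σℤ-comm t ⟨
  Σℤ (λ i → Σℤ (λ j → t i j))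
    ≡⟨ Σℤ-cong (λ i → trans (pull (sgn (suc i)) (b i) (λ j → sgn j * (a j * x i j)))
                            (Σℤ-cong (λ j → rhs-term i j))) ⟨
  Σℤ (λ i → sgn (suc i) * (b i * Σℤ (λ j → sgn j * (a j * x i j)))) ∎
  where
  open ≡-Reasoning
  t : Fin n → Fin m → ℤ
  t i j = - (sgn i * sgn j * a j * b i * x i j)
  pull : ∀ {k} s c (f : Fin k → ℤ) → s * (c * Σℤ f) ≡ Σℤ (λ i → s * (c * f i))
  pull s c f = trans (cong (s *_) (*-distribˡ-Σℤ c f)) (*-distribˡ-Σℤ s (λ i → c * f i))
  lhs-term : ∀ i j → sgn (suc j) * (a j * (sgn i * (b i * x i j))) ≡ t i j
  lhs-term i j = trans (cong (_* (a j * (sgn i * (b i * x i j)))) (sgn-suc j))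
    (solve 5 (λ si sj a b x → (:- sj) :* (a :* (si :* (b :* x))) := :- (si :* sj :* a :* b :* x))
           refl (sgn i) (sgn j) (a j) (b i) (x i j))
  rhs-term : ∀ i j → sgn (suc i) * (b i * (sgn j * (a j * x i j))) ≡ t i j
  rhs-term i j = trans (cong (_* (b i * (sgn j * (a j * x i j)))) (sgn-suc i))
    (solve 5 (λ si sj a b x → (:- si) :* (b :* (sj :* (a :* x))) := :- (si :* sj :* a :* b :* x))
           refl (sgn i) (sgn j) (a j) (b i) (x i j))

colMinor : Mat ℤ (suc n) → Fin (suc n) → Mat ℤ n
colMinor A i r c = A (punchIn i r) (suc c)

det-expand-column₀ : (A : Mat ℤ (suc n)) → det A ≡ Σℤ (λ i → sgn i * (A i zero * det (colMinor A i)))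
det-expand-column₀ {zero}  A = refl
det-expand-column₀ {suc n} A = cong (λ t → + 1 * (A zero zero * det (minor A zero)) + t) (begin
  Σℤ (λ j → sgn (suc j) * (A zero (suc j) * det (minor A (suc j))))
    ≡⟨ Σℤ-cong (λ j → cong (λ t → sgn (suc j) * (A zero (suc j) * t))
                           (det-expand-column₀ (minor A (suc j)))) ⟩
  Σℤ (λ j → sgn (suc j) * (A zero (suc j) * Σℤ (λ i → sgn i * (A (suc i) zero * x i j))))
    ≡⟨ Σℤ-sgn-comm (λ j → A zero (suc j)) (λ i → A (suc i) zero) x ⟩
  Σℤ (λ i → sgn (suc i) * (A (suc i) zero * det (colMinor A (suc i)))) ∎)
  where
  open ≡-Reasoning
  x : Fin (suc n) → Fin (suc n) → ℤ
  x i j = det (λ r c → A (suc (punchIn i r)) (suc (punchIn j c)))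

det-transpose : (A : Mat ℤ n) → det (transpose A) ≡ det A
det-transpose {zero}  A = refl
det-transpose {suc n} A =
  trans (Σℤ-cong (λ i → cong (λ t → sgn i * (A i zero * t)) (det-transpose (colMinor A i))))
        (sym (det-expand-column₀ A))

swap₀₁ : Fin (suc (suc n)) → Fin (suc (suc n))
swap₀₁ zero          = suc zero
swap₀₁ (suc zero)    = zero
swap₀₁ (suc (suc c)) = suc (suc c)

swap₀₁-suc : (c : Fin (suc n)) → swap₀₁ (suc c) ≡ punchIn (suc zero) c
swap₀₁-suc zero    = refl
swap₀₁-suc (suc c) = refl

swap₀₁-punchIn₁ : (c : Fin (suc n)) → swap₀₁ (punchIn (suc zero) c) ≡ suc c
swap₀₁-punchIn₁ zero    = refl
swap₀₁-punchIn₁ (suc c) = refl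

swap₀₁-punchIn : (j : Fin (suc n)) (c : Fin (suc (suc n))) →
                 swap₀₁ (punchIn (suc (suc j)) c) ≡ punchIn (suc (suc j)) (swap₀₁ c)
swap₀₁-punchIn j zero          = refl
swap₀₁-punchIn j (suc zero)    = refl
swap₀₁-punchIn j (suc (suc c)) = refl

expansion-from-column₂ : Mat ℤ (suc (suc n)) → ℤ
expansion-from-column₂ A = Σℤ (λ j → sgn j * (A zero (suc (suc j)) * det (minor A (suc (suc j)))))

-- Swapping columns 0 and 1 exchanges the first two terms of the expansion along row 0
-- and swaps columns 0 and 1 in every later minor.
det-swap-columns₀₁ : (A : Mat ℤ (suc (suc n))) → det (λ r c → A r (swap₀₁ c)) ≡ - det A
det-swap-columns₀₁ {n} A = begin
  det A′
    ≡⟨ cong₂ (λ x y → + 1 * (a₁ * x) + (- + 1 * (a₀ * y) + expansion-from-column₂ A′))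
             (det-cong (λ r c → cong (A (suc r)) (swap₀₁-suc c)))
             (det-cong (λ r c → cong (A (suc r)) (swap₀₁-punchIn₁ c))) ⟩
  + 1 * (a₁ * d₁) + (- + 1 * (a₀ * d₀) + expansion-from-column₂ A′)
    ≡⟨ cong (λ t → + 1 * (a₁ * d₁) + (- + 1 * (a₀ * d₀) + t)) (later-columns n A) ⟩
  + 1 * (a₁ * d₁) + (- + 1 * (a₀ * d₀) + - expansion-from-column₂ A)
    ≡⟨ solve 5 (λ a₁ d₁ a₀ d₀ e → con (+ 1) :* (a₁ :* d₁) :+ (:- con (+ 1) :* (a₀ :* d₀) :+ :- e)
                                  := :- (con (+ 1) :* (a₀ :* d₀) :+ (:- con (+ 1) :* (a₁ :* d₁) :+ e)))
             refl a₁ d₁ a₀ d₀ (expansion-from-column₂ A) ⟩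
  - det A ∎
  where
  open ≡-Reasoning
  A′ : Mat ℤ (suc (suc n))
  A′ r c = A r (swap₀₁ c)
  a₀ a₁ d₀ d₁ : ℤ
  a₀ = A zero zero
  a₁ = A zero (suc zero)
  d₀ = det (minor A zero)
  d₁ = det (minor A (suc zero))
  later-columns : ∀ n (A : Mat ℤ (suc (suc n))) →
                  expansion-from-column₂ (λ r c → A r (swap₀₁ c)) ≡ - expansion-from-column₂ A
  later-columns zero    A = refl
  later-columns (suc n) A = trans (Σℤ-cong term) (sym (neg-distrib-Σℤ (λ j → sgn j * (A zero (suc (suc j)) * d j))))
    where
    d : Fin (suc n) → ℤ
    d j = det (minor A (suc (suc j)))
    term : ∀ j → sgn j * (A zero (suc (suc j)) * det (minor (λ r c → A r (swap₀₁ c)) (suc (suc j))))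
                 ≡ - (sgn j * (A zero (suc (suc j)) * d j))
    term j = trans (cong (λ t → sgn j * (A zero (suc (suc j)) * t))
                         (trans (det-cong (λ r c → cong (A (suc r)) (swap₀₁-punchIn j c)))
                                (det-swap-columns₀₁ (minor A (suc (suc j))))))
                   (solve 3 (λ s a d → s :* (a :* :- d) := :- (s :* (a :* d))) refl (sgn j) (A zero (suc (suc j))) (d j))

det-swap-rows₀₁ : (A : Mat ℤ (suc (suc n))) → det (A ∘ swap₀₁) ≡ - det A
det-swap-rows₀₁ A = trans (sym (det-transpose (A ∘ swap₀₁)))
  (trans (det-swap-columns₀₁ (transpose A)) (cong -_ (det-transpose A)))

-- Alternating multilinear forms

record IsAlternatingForm (G : Mat ℤ n → ℤ) : Set where
  field
    resp-≈ᴹ     : {A B : Mat ℤ n} → A ≈ᴹ B → G A ≡ G B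
    row-linear  : (A : Mat ℤ n) (j : Fin n) (a b : ℤ) (u w : Fin n → ℤ) →
                  G (A [ j ]≔ (λ c → a * u c + b * w c)) ≡ a * G (A [ j ]≔ u) + b * G (A [ j ]≔ w)
    alternating : (A : Mat ℤ n) {i j : Fin n} → i ≢ j → (∀ c → A i c ≡ A j c) → G A ≡ + 0

Σℕ : (Fin n → ℕ) → ℕ
Σℕ {zero}  f = 0
Σℕ {suc n} f = f zero ℕ.+ Σℕ (f ∘ suc)

Σℕ-mono-≤ : {f g : Fin n → ℕ} → (∀ x → f x ℕ.≤ g x) → Σℕ f ℕ.≤ Σℕ g
Σℕ-mono-≤ {zero}  f≤g = ℕ.z≤n
Σℕ-mono-≤ {suc n} f≤g = ℕP.+-mono-≤ (f≤g zero) (Σℕ-mono-≤ (f≤g ∘ suc))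

Σℕ-mono-< : {f g : Fin n → ℕ} → (∀ x → f x ℕ.≤ g x) → (y : Fin n) → f y ℕ.< g y → Σℕ f ℕ.< Σℕ g
Σℕ-mono-< f≤g zero    fy<gy = ℕP.+-mono-<-≤ fy<gy (Σℕ-mono-≤ (f≤g ∘ suc))
Σℕ-mono-< f≤g (suc y) fy<gy = ℕP.+-mono-≤-< (f≤g zero) (Σℕ-mono-< (f≤g ∘ suc) y fy<gy)

noIndicator : {P : Set} → Dec P → ℕ
noIndicator (yes _) = 0
noIndicator (no  _) = 1

noIndicator-yes : {P : Set} (d : Dec P) → P → noIndicator d ≡ 0
noIndicator-yes (yes _) p = refl
noIndicator-yes (no ¬p) p = ⊥-elim (¬p p)

noIndicator-no : {P : Set} (d : Dec P) → ¬ P → noIndicator d ≡ 1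
noIndicator-no (yes p) ¬p = ⊥-elim (¬p p)
noIndicator-no (no _)  ¬p = refl

noIndicator≤1 : {P : Set} (d : Dec P) → noIndicator d ℕ.≤ 1
noIndicator≤1 (yes _) = ℕ.z≤n
noIndicator≤1 (no  _) = ℕP.≤-refl

noIndicator-cong : {P Q : Set} (d : Dec P) (e : Dec Q) → (P → Q) → (Q → P) → noIndicator d ≡ noIndicator e
noIndicator-cong (yes _) (yes _) P→Q Q→P = refl
noIndicator-cong (yes p) (no ¬q) P→Q Q→P = ⊥-elim (¬q (P→Q p))
noIndicator-cong (no ¬p) (yes q) P→Q Q→P = ⊥-elim (¬p (Q→P q))
noIndicator-cong (no _)  (no _)  P→Q Q→P = refl

isMoved : (Fin n → Fin n) → Fin n → ℕ
isMoved f x = noIndicator (f x F.≟ x)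

#moved : (Fin n → Fin n) → ℕ
#moved f = Σℕ (isMoved f)

-- Exchanging the values at i and j = f i turns j into a fixed point and creates no new moved point.
#moved-exchange : (f : Fin n → Fin n) {i : Fin n} → f i ≢ i → f (f i) ≢ f i →
                  #moved ((f [ i ]≔ f (f i)) [ f i ]≔ f i) ℕ.< #moved f
#moved-exchange {n} f {i} fi≢i ffi≢fi = Σℕ-mono-< pointwise j (begin-strict
  isMoved f′ j ≡⟨ j-fixed ⟩
  0            <⟨ ℕP.0<1+n ⟩
  1            ≡⟨ noIndicator-no (f j F.≟ j) ffi≢fi ⟨
  isMoved f j  ∎)
  where
  open ℕP.≤-Reasoning
  j : Fin n
  j = f i
  f′ : Fin n → Fin n
  f′ = (f [ i ]≔ f j) [ j ]≔ j
  j-fixed : isMoved f′ j ≡ 0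
  j-fixed = noIndicator-yes (f′ j F.≟ j) ([]≔-updates (f [ i ]≔ f j) j j)
  pointwise : ∀ x → isMoved f′ x ℕ.≤ isMoved f x
  pointwise x with x F.≟ j | x F.≟ i
  ... | yes refl | _        = ℕP.≤-trans (ℕP.≤-reflexive j-fixed) ℕ.z≤n
  ... | no x≢j   | yes refl = ℕP.≤-trans (noIndicator≤1 (f′ x F.≟ x))
                                         (ℕP.≤-reflexive (sym (noIndicator-no (f x F.≟ x) fi≢i)))
  ... | no x≢j   | no x≢i   = ℕP.≤-reflexive
                                (noIndicator-cong (f′ x F.≟ x) (f x F.≟ x) (trans (sym f′x≡fx)) (trans f′x≡fx))
    where
    f′x≡fx : f′ x ≡ f x
    f′x≡fx = trans ([]≔-minimal (f [ i ]≔ f j) j x≢j) ([]≔-minimal f (f j) x≢i)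

basisRows : (Fin n → Fin n) → Mat ℤ n
basisRows f i = idℤ (f i)

basisRows-exchange : (f : Fin n → Fin n) (i j : Fin n) →
  basisRows ((f [ i ]≔ f j) [ j ]≔ f i) ≈ᴹ ((basisRows f [ i ]≔ basisRows f j) [ j ]≔ basisRows f i)
basisRows-exchange f i j r c = trans
  (cong (λ row → row c) (VecP.map-updateAt {f = idℤ} {g = const (f i)} (λ _ → refl) (f [ i ]≔ f j) j r))
  ([]≔-cong j inner (λ _ → refl) r c)
  where
  inner : ∀ r′ c′ → basisRows (f [ i ]≔ f j) r′ c′ ≡ (basisRows f [ i ]≔ basisRows f j) r′ c′
  inner r′ c′ = cong (λ row → row c′) (VecP.map-updateAt {f = idℤ} {g = const (f j)} (λ _ → refl) f i r′)

module AlternatingForm {n : ℕ} {G : Mat ℤ n → ℤ} (G-form : IsAlternatingForm G) where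
  open IsAlternatingForm G-form

  row-combination : (A : Mat ℤ n) (j : Fin n) (a : Fin k → ℤ) (w : Fin k → Fin n → ℤ) →
                    G (A [ j ]≔ (λ c → Σℤ (λ l → a l * w l c))) ≡ Σℤ (λ l → a l * G (A [ j ]≔ w l))
  row-combination {zero}  A j a w = row-linear A j (+ 0) (+ 0) (const (+ 0)) (const (+ 0))
  row-combination {suc k} A j a w = begin
    G (A [ j ]≔ (λ c → a zero * w zero c + rest c))
      ≡⟨ resp-≈ᴹ ([]≔-cong j (λ _ _ → refl)
                             (λ c → cong (λ t → a zero * w zero c + t) (sym (ℤP.*-identityˡ (rest c))))) ⟩
    G (A [ j ]≔ (λ c → a zero * w zero c + + 1 * rest c))
      ≡⟨ row-linear A j (a zero) (+ 1) (w zero) rest ⟩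
    a zero * G (A [ j ]≔ w zero) + + 1 * G (A [ j ]≔ rest)
      ≡⟨ cong (λ t → a zero * G (A [ j ]≔ w zero) + t)
              (trans (ℤP.*-identityˡ (G (A [ j ]≔ rest))) (row-combination A j (a ∘ suc) (w ∘ suc))) ⟩
    Σℤ (λ l → a l * G (A [ j ]≔ w l)) ∎
    where
    open ≡-Reasoning
    rest : Fin n → ℤ
    rest c = Σℤ (λ l → a (suc l) * w (suc l) c)

  row-expansion : (A : Mat ℤ n) (j : Fin n) (v : Fin n → ℤ) →
                  G (A [ j ]≔ v) ≡ Σℤ (λ l → v l * G (A [ j ]≔ idℤ l))
  row-expansion A j v = trans (resp-≈ᴹ ([]≔-cong j (λ _ _ → refl) (λ c → sym (Σℤ-*idℤ v c))))
                              (row-combination A j v idℤ)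

  swap-rows : (A : Mat ℤ n) {i j : Fin n} → i ≢ j → G ((A [ i ]≔ A j) [ j ]≔ A i) ≡ - G A
  swap-rows A {i} {j} i≢j = begin
    T b a   ≡⟨ ℤ+.inverseʳ-unique (T a b) (T b a) T-antisymmetric ⟩
    - T a b ≡⟨ cong -_ (resp-≈ᴹ (≈ᴹ-trans ([]≔-cong j ([]≔-self A i) (λ _ → refl)) ([]≔-self A j))) ⟩
    - G A   ∎
    where
    open ≡-Reasoning
    a b : Fin n → ℤ
    a = A i
    b = A j
    T : (Fin n → ℤ) → (Fin n → ℤ) → ℤ
    T u v = G ((A [ i ]≔ u) [ j ]≔ v)
    _⊕_ : (Fin n → ℤ) → (Fin n → ℤ) → Fin n → ℤ
    (u ⊕ v) c = + 1 * u c + + 1 * v c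
    T-additiveʳ : ∀ u v w → T u (v ⊕ w) ≡ T u v + T u w
    T-additiveʳ u v w = trans (row-linear (A [ i ]≔ u) j (+ 1) (+ 1) v w)
                              (cong₂ _+_ (ℤP.*-identityˡ (T u v)) (ℤP.*-identityˡ (T u w)))
    T-additiveˡ : ∀ u v w → T (u ⊕ v) w ≡ T u w + T v w
    T-additiveˡ u v w = begin
      G ((A [ i ]≔ (u ⊕ v)) [ j ]≔ w)                       ≡⟨ resp-≈ᴹ ([]≔-comm A (u ⊕ v) w i≢j) ⟩
      G ((A [ j ]≔ w) [ i ]≔ (u ⊕ v))                       ≡⟨ row-linear (A [ j ]≔ w) i (+ 1) (+ 1) u v ⟩
      + 1 * G′ u + + 1 * G′ v                               ≡⟨ cong₂ _+_ (ℤP.*-identityˡ (G′ u)) (ℤP.*-identityˡ (G′ v)) ⟩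
      G ((A [ j ]≔ w) [ i ]≔ u) + G ((A [ j ]≔ w) [ i ]≔ v) ≡⟨ cong₂ _+_ (resp-≈ᴹ ([]≔-comm A u w i≢j))
                                                                         (resp-≈ᴹ ([]≔-comm A v w i≢j)) ⟨
      T u w + T v w                                         ∎
      where
      G′ : (Fin n → ℤ) → ℤ
      G′ x = G ((A [ j ]≔ w) [ i ]≔ x)
    T-diagonal : ∀ u → T u u ≡ + 0
    T-diagonal u = alternating ((A [ i ]≔ u) [ j ]≔ u) i≢j (λ c → cong (λ row → row c) (begin
      ((A [ i ]≔ u) [ j ]≔ u) i ≡⟨ []≔-minimal (A [ i ]≔ u) u i≢j ⟩
      (A [ i ]≔ u) i            ≡⟨ []≔-updates A i u ⟩
      u                         ≡⟨ []≔-updates (A [ i ]≔ u) j u ⟨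
      ((A [ i ]≔ u) [ j ]≔ u) j ∎))
    T-antisymmetric : T a b + T b a ≡ + 0
    T-antisymmetric = begin
      T a b + T b a                     ≡⟨ cong₂ _+_ (ℤP.+-identityˡ (T a b)) (ℤP.+-identityʳ (T b a)) ⟨
      (+ 0 + T a b) + (T b a + + 0)     ≡⟨ cong₂ (λ x y → (x + T a b) + (T b a + y)) (T-diagonal a) (T-diagonal b) ⟨
      (T a a + T a b) + (T b a + T b b) ≡⟨ cong₂ _+_ (T-additiveʳ a a b) (T-additiveʳ b a b) ⟨
      T a (a ⊕ b) + T b (a ⊕ b)         ≡⟨ T-additiveˡ a b (a ⊕ b) ⟨
      T (a ⊕ b) (a ⊕ b)                 ≡⟨ T-diagonal (a ⊕ b) ⟩
      + 0                               ∎

  basisRows-vanish : G idℤ ≡ + 0 → (f : Fin n → Fin n) → G (basisRows f) ≡ + 0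
  basisRows-vanish G-id =
    All.wfRec (On.wellFounded #moved ℕInd.<-wellFounded) _ (λ f → G (basisRows f) ≡ + 0) step
    where
    step : ∀ f → (∀ {f′} → #moved f′ ℕ.< #moved f → G (basisRows f′) ≡ + 0) → G (basisRows f) ≡ + 0
    step f rec with FP.all? (λ x → f x F.≟ x)
    ... | yes f≗id = trans (resp-≈ᴹ (λ r c → cong (λ t → idℤ t c) (f≗id r))) G-id
    ... | no ¬f≗id with FP.¬∀⟶∃¬ n _ (λ x → f x F.≟ x) ¬f≗id
    ...   | i , fi≢i with f (f i) F.≟ f i
    ...     | yes ffi≡fi = alternating (basisRows f) (fi≢i ∘ sym) (λ c → cong (λ t → idℤ t c) (sym ffi≡fi))
    ...     | no  ffi≢fi = begin
      G E                                  ≡⟨ ℤP.neg-involutive (G E) ⟨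
      - - G E                              ≡⟨ cong -_ (swap-rows E (fi≢i ∘ sym)) ⟨
      - G ((E [ i ]≔ E (f i)) [ f i ]≔ E i) ≡⟨ cong -_ (resp-≈ᴹ (basisRows-exchange f i (f i))) ⟨
      - G (basisRows f′)                   ≡⟨ cong -_ (rec (#moved-exchange f fi≢i ffi≢fi)) ⟩
      + 0                                  ∎
      where
      open ≡-Reasoning
      E : Mat ℤ n
      E = basisRows f
      f′ : Fin n → Fin n
      f′ = (f [ i ]≔ f (f i)) [ f i ]≔ f i

  -- Expand the rows of A one at a time into standard basis rows.
  vanish : G idℤ ≡ + 0 → (A : Mat ℤ n) → G A ≡ + 0
  vanish G-id A = vanish-on-basis-tail n ℕP.≤-refl A id (λ i n≤i → ⊥-elim (ℕP.<⇒≱ (FP.toℕ<n i) n≤i))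
    where
    vanish-on-basis-tail : ∀ m → m ℕ.≤ n → (A : Mat ℤ n) (f : Fin n → Fin n) →
                           (∀ i → m ℕ.≤ toℕ i → ∀ c → A i c ≡ idℤ (f i) c) → G A ≡ + 0
    vanish-on-basis-tail zero    _   A f tail = trans (resp-≈ᴹ (λ i → tail i ℕ.z≤n)) (basisRows-vanish G-id f)
    vanish-on-basis-tail (suc m) m<n A f tail = begin
      G A                                    ≡⟨ resp-≈ᴹ ([]≔-self A ρ) ⟨
      G (A [ ρ ]≔ A ρ)                       ≡⟨ row-expansion A ρ (A ρ) ⟩
      Σℤ (λ l → A ρ l * G (A [ ρ ]≔ idℤ l)) ≡⟨ Σℤ-zero (λ l → trans (cong (A ρ l *_) (vanish-on-basis-tail m
                                                  (ℕP.<⇒≤ m<n) (A [ ρ ]≔ idℤ l) (f [ ρ ]≔ l) (tail′ l)))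
                                                  (ℤP.*-zeroʳ (A ρ l))) ⟩
      + 0                                    ∎
      where
      open ≡-Reasoning
      ρ : Fin n
      ρ = fromℕ< m<n
      tail′ : ∀ l i → m ℕ.≤ toℕ i → ∀ c → (A [ ρ ]≔ idℤ l) i c ≡ idℤ ((f [ ρ ]≔ l) i) c
      tail′ l i m≤i c with i F.≟ ρ
      ... | yes refl = trans (cong (λ row → row c) ([]≔-updates A ρ (idℤ l)))
                             (cong (λ t → idℤ t c) (sym ([]≔-updates f ρ l)))
      ... | no  i≢ρ  = trans (cong (λ row → row c) ([]≔-minimal A (idℤ l) i≢ρ))
                             (trans (tail i m<i c) (cong (λ t → idℤ t c) (sym ([]≔-minimal f l i≢ρ))))
        where
        m<i : m ℕ.< toℕ i
        m<i = ℕP.≤∧≢⇒< m≤i (λ m≡i → i≢ρ (FP.toℕ-injective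
                (trans (sym m≡i) (sym (FP.toℕ-fromℕ< m<n)))))

-- Multiplicativity of the determinant and the adjugate

det-row-linear : (A : Mat ℤ n) (j : Fin n) (a b : ℤ) (u w : Fin n → ℤ) →
                 det (A [ j ]≔ (λ c → a * u c + b * w c)) ≡ a * det (A [ j ]≔ u) + b * det (A [ j ]≔ w)
det-row-linear {suc n} A zero a b u w = trans
  (Σℤ-cong (λ c → solve 6 (λ s a u b w d → s :* ((a :* u :+ b :* w) :* d)
                                           := a :* (s :* (u :* d)) :+ b :* (s :* (w :* d)))
                          refl (sgn c) a (u c) b (w c) (det (minor A c))))
  (Σℤ-linear a b (λ c → sgn c * (u c * det (minor A c))) (λ c → sgn c * (w c * det (minor A c))))
det-row-linear {suc (suc n)} A (suc j) a b u w = begin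
  det (A [ suc j ]≔ (λ c → a * u c + b * w c))
    ≡⟨ expand (λ c → a * u c + b * w c) ⟩
  Σℤ (λ c → sgn c * (A zero c * det (minor A c [ j ]≔ (λ c′ → a * u (punchIn c c′) + b * w (punchIn c c′)))))
    ≡⟨ Σℤ-cong (λ c → trans (cong (λ t → sgn c * (A zero c * t))
                                  (det-row-linear (minor A c) j a b (u ∘ punchIn c) (w ∘ punchIn c)))
         (solve 6 (λ s x a u b w → s :* (x :* (a :* u :+ b :* w)) := a :* (s :* (x :* u)) :+ b :* (s :* (x :* w)))
                refl (sgn c) (A zero c) a (U u c) b (U w c))) ⟩
  Σℤ (λ c → a * (sgn c * (A zero c * U u c)) + b * (sgn c * (A zero c * U w c)))
    ≡⟨ Σℤ-linear a b (λ c → sgn c * (A zero c * U u c)) (λ c → sgn c * (A zero c * U w c)) ⟩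
  a * Σℤ (λ c → sgn c * (A zero c * U u c)) + b * Σℤ (λ c → sgn c * (A zero c * U w c))
    ≡⟨ cong₂ (λ x y → a * x + b * y) (expand u) (expand w) ⟨
  a * det (A [ suc j ]≔ u) + b * det (A [ suc j ]≔ w) ∎
  where
  open ≡-Reasoning
  U : (Fin (suc (suc n)) → ℤ) → Fin (suc (suc n)) → ℤ
  U v c = det (minor A c [ j ]≔ (v ∘ punchIn c))
  expand : ∀ v → det (A [ suc j ]≔ v) ≡ Σℤ (λ c → sgn c * (A zero c * U v c))
  expand v = Σℤ-cong (λ c → cong (λ t → sgn c * (A zero c * t)) (det-cong (minor-[]≔ A j v c)))

det-rows₀₁-equal : (A : Mat ℤ (suc (suc n))) → (∀ c → A zero c ≡ A (suc zero) c) → det A ≡ + 0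
det-rows₀₁-equal A A₀≗A₁ = i≡-i⇒i≡0 (det A) (trans (sym (det-cong swapped≈A)) (det-swap-rows₀₁ A))
  where
  swapped≈A : (A ∘ swap₀₁) ≈ᴹ A
  swapped≈A zero          c = sym (A₀≗A₁ c)
  swapped≈A (suc zero)    c = A₀≗A₁ c
  swapped≈A (suc (suc r)) c = refl

-- Exchanging rows 1 and j+2 makes rows 0 and 1 equal, and negates det
-- because it exchanges rows 0 and j+1 of every minor along row 0.
det-rows₀-equal : IsAlternatingForm (det {suc n}) → (A : Mat ℤ (suc (suc n))) (j : Fin (suc n)) →
                  (∀ c → A zero c ≡ A (suc j) c) → det A ≡ + 0
det-rows₀-equal _      A zero    A≗ = det-rows₀₁-equal A A≗
det-rows₀-equal {n} det-sn A (suc j) A≗ = begin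
  det A     ≡⟨ ℤP.neg-involutive (det A) ⟨
  - - det A ≡⟨ cong -_ det-B ⟨
  - det B   ≡⟨ cong -_ (det-rows₀₁-equal B A≗) ⟩
  + 0       ∎
  where
  open ≡-Reasoning
  B : Mat ℤ (suc (suc n))
  B = (A [ suc zero ]≔ A (suc (suc j))) [ suc (suc j) ]≔ A (suc zero)
  det-B : det B ≡ - det A
  det-B = trans (Σℤ-cong (λ c → trans (cong (λ t → sgn c * (A zero c * t)) (begin
      det (minor B c)
        ≡⟨ det-cong (≈ᴹ-trans (minor-[]≔ (A [ suc zero ]≔ A (suc (suc j))) (suc j) (A (suc zero)) c)
                              ([]≔-cong (suc j) (minor-[]≔ A zero (A (suc (suc j))) c) (λ _ → refl))) ⟩
      det ((minor A c [ zero ]≔ minor A c (suc j)) [ suc j ]≔ minor A c zero)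
        ≡⟨ AlternatingForm.swap-rows det-sn (minor A c) {zero} {suc j} (λ ()) ⟩
      - det (minor A c) ∎))
    (solve 3 (λ s a d → s :* (a :* :- d) := :- (s :* (a :* d))) refl (sgn c) (A zero c) (det (minor A c)))))
    (sym (neg-distrib-Σℤ (λ c → sgn c * (A zero c * det (minor A c)))))

mutual
  det-isAlternatingForm : IsAlternatingForm (det {n})
  det-isAlternatingForm = record
    { resp-≈ᴹ     = det-cong
    ; row-linear  = det-row-linear
    ; alternating = det-alternating
    }

  det-alternating : (A : Mat ℤ n) {i j : Fin n} → i ≢ j → (∀ c → A i c ≡ A j c) → det A ≡ + 0
  det-alternating {suc n}       A {zero}  {zero}  0≢0 _   = ⊥-elim (0≢0 refl)
  det-alternating {suc (suc n)} A {zero}  {suc j} _   A≗ =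
    det-rows₀-equal det-isAlternatingForm A j A≗
  det-alternating {suc (suc n)} A {suc i} {zero}  _   A≗ =
    det-rows₀-equal det-isAlternatingForm A i (sym ∘ A≗)
  det-alternating {suc n}       A {suc i} {suc j} i≢j A≗ = Σℤ-zero (λ c → trans
    (cong (λ t → sgn c * (A zero c * t)) (det-alternating (minor A c) (i≢j ∘ cong suc) (A≗ ∘ punchIn c)))
    (trans (cong (sgn c *_) (ℤP.*-zeroʳ (A zero c))) (ℤP.*-zeroʳ (sgn c))))

det-idℤ : det (idℤ {n}) ≡ + 1
det-idℤ {zero}  = refl
det-idℤ {suc n} = begin
  det I                                  ≡⟨ Σℤ-select (λ j → sgn j * (I zero j * det (minor I j))) zero off-diagonal ⟩
  + 1 * (I zero zero * det (minor I zero)) ≡⟨ cong₂ (λ x d → + 1 * (x * d)) (idℤ-diag {suc n} zero)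
                                                   (trans (det-cong {n} idℤ-suc) (det-idℤ {n})) ⟩
  + 1                                    ∎
  where
  open ≡-Reasoning
  I : Mat ℤ (suc n)
  I = idℤ
  off-diagonal : ∀ j → j ≢ zero → sgn j * (I zero j * det (minor I j)) ≡ + 0
  off-diagonal j j≢0 = trans (cong (λ x → sgn j * (x * det (minor I j))) (idℤ-off (j≢0 ∘ sym)))
                             (ℤP.*-zeroʳ (sgn j))

det-*ₗ : (c : ℤ) (A : Mat ℤ n) → det (c *ₗ A) ≡ c ^ n * det A
det-*ₗ {zero}  c A = refl
det-*ₗ {suc n} c A = begin
  Σℤ (λ j → sgn j * (c * A zero j * det (c *ₗ minor A j)))
    ≡⟨ Σℤ-cong (λ j → trans (cong (λ t → sgn j * (c * A zero j * t)) (det-*ₗ c (minor A j)))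
         (solve 5 (λ s c a p d → s :* (c :* a :* (p :* d)) := c :* p :* (s :* (a :* d))) refl
                (sgn j) c (A zero j) (c ^ n) (det (minor A j)))) ⟩
  Σℤ (λ j → c ^ suc n * (sgn j * (A zero j * det (minor A j))))
    ≡⟨ *-distribˡ-Σℤ (c ^ suc n) (λ j → sgn j * (A zero j * det (minor A j))) ⟨
  c ^ suc n * det A ∎
  where open ≡-Reasoning

det-*ₗidℤ : (c : ℤ) → det (c *ₗ idℤ {n}) ≡ c ^ n
det-*ₗidℤ {n} c = trans (det-*ₗ c (idℤ {n}))
                        (trans (cong (c ^ n *_) (det-idℤ {n})) (ℤP.*-identityʳ (c ^ n)))

det-*ᴹ : (A B : Mat ℤ n) → det (A *ᴹ B) ≡ det A * det B
det-*ᴹ {n} A B = ℤP.i-j≡0⇒i≡j _ _ (AlternatingForm.vanish G-form G-idℤ A)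
  where
  G : Mat ℤ n → ℤ
  G X = det (X *ᴹ B) - det X * det B

  G-linear : (X : Mat ℤ n) (j : Fin n) (a b : ℤ) (u w : Fin n → ℤ) →
             G (X [ j ]≔ (λ c → a * u c + b * w c)) ≡ a * G (X [ j ]≔ u) + b * G (X [ j ]≔ w)
  G-linear X j a b u w = begin
    D (λ c → a * u c + b * w c) - E (λ c → a * u c + b * w c) * det B
      ≡⟨ cong₂ (λ x y → x - y * det B) D-linear (det-row-linear X j a b u w) ⟩
    (a * D u + b * D w) - (a * E u + b * E w) * det B
      ≡⟨ solve 7 (λ a b x y p q d → (a :* x :+ b :* y) :- (a :* p :+ b :* q) :* d
                                    := a :* (x :- p :* d) :+ b :* (y :- q :* d))
               refl a b (D u) (D w) (E u) (E w) (det B) ⟩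
    a * (D u - E u * det B) + b * (D w - E w * det B) ∎
    where
    open ≡-Reasoning
    D E : (Fin n → ℤ) → ℤ
    D v = det ((X [ j ]≔ v) *ᴹ B)
    E v = det (X [ j ]≔ v)
    D≡ : ∀ v → D v ≡ det ((X *ᴹ B) [ j ]≔ (v ᵛ*ᴹ B))
    D≡ v = det-cong ([]≔-*ᴹ X B j v)
    D-linear : D (λ c → a * u c + b * w c) ≡ a * D u + b * D w
    D-linear = begin
      D (λ c → a * u c + b * w c)
        ≡⟨ trans (D≡ _) (det-cong ([]≔-cong j (λ _ _ → refl) (ᵛ*ᴹ-linear a b u w B))) ⟩
      det ((X *ᴹ B) [ j ]≔ (λ c → a * (u ᵛ*ᴹ B) c + b * (w ᵛ*ᴹ B) c))
        ≡⟨ det-row-linear (X *ᴹ B) j a b (u ᵛ*ᴹ B) (w ᵛ*ᴹ B) ⟩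
      a * det ((X *ᴹ B) [ j ]≔ (u ᵛ*ᴹ B)) + b * det ((X *ᴹ B) [ j ]≔ (w ᵛ*ᴹ B))
        ≡⟨ cong₂ (λ x y → a * x + b * y) (D≡ u) (D≡ w) ⟨
      a * D u + b * D w ∎

  G-form : IsAlternatingForm G
  G-form = record
    { resp-≈ᴹ     = λ X≈Y → cong₂ (λ x y → x - y * det B) (det-cong (*ᴹ-congʳ B X≈Y)) (det-cong X≈Y)
    ; row-linear  = G-linear
    ; alternating = λ X i≢j Xᵢ≗Xⱼ → cong₂ (λ x y → x - y * det B)
                      (det-alternating (X *ᴹ B) i≢j (λ c → Σℤ-cong (λ k → cong (_* B k c) (Xᵢ≗Xⱼ k))))
                      (det-alternating X i≢j Xᵢ≗Xⱼ)
    }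

  G-idℤ : G idℤ ≡ + 0
  G-idℤ = trans (cong₂ (λ x y → x - y * det B) (det-cong (*ᴹ-identityˡ B)) (det-idℤ {n}))
                (solve 1 (λ x → x :- con (+ 1) :* x := con (+ 0)) refl (det B))

det-*ᴹ-scalar : (A B : Mat ℤ n) {c : ℤ} → (A *ᴹ B) ≈ᴹ (c *ₗ idℤ) → det A * det B ≡ c ^ n
det-*ᴹ-scalar {n} A B {c} AB≈cI = trans (sym (det-*ᴹ A B)) (trans (det-cong AB≈cI) (det-*ₗidℤ {n} c))

adj : Mat ℤ n → Mat ℤ n
adj A k j = det (A [ j ]≔ idℤ k)

*ᴹ-adj : (A : Mat ℤ n) → (A *ᴹ adj A) ≈ᴹ (det A *ₗ idℤ)
*ᴹ-adj A i j = trans (sym (AlternatingForm.row-expansion det-isAlternatingForm A j (A i)))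
                     (by-cases (i F.≟ j))
  where
  by-cases : Dec (i ≡ j) → det (A [ j ]≔ A i) ≡ det A * idℤ i j
  by-cases (yes refl) = trans (det-cong ([]≔-self A i))
                              (sym (trans (cong (det A *_) (idℤ-diag i)) (ℤP.*-identityʳ (det A))))
  by-cases (no i≢j)   = trans (det-alternating (A [ j ]≔ A i) i≢j (λ c → cong (λ row → row c)
                                (trans ([]≔-minimal A (A i) i≢j) (sym ([]≔-updates A j (A i))))))
                              (sym (trans (cong (det A *_) (idℤ-off i≢j)) (ℤP.*-zeroʳ (det A))))

-- Scalar inverses and the Smith normal form

-- det B ≢ 0, and B · adj B = det B · I lets us cancel det B.
*ᴹ-scalar-comm : (A B : Mat ℤ n) {c : ℤ} → c ≢ + 0 → (A *ᴹ B) ≈ᴹ (c *ₗ idℤ) →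
                 (B *ᴹ A) ≈ᴹ (c *ₗ idℤ)
*ᴹ-scalar-comm {n} A B {c} c≢0 AB≈cI = *ₗ-cancel (det B) detB≢0 (begin
  det B *ₗ (B *ᴹ A)          ≈⟨ *ᴹ-*ₗ (det B) B A ⟨
  B *ᴹ (det B *ₗ A)          ≈⟨ *ᴹ-congˡ B c·adjB≈detB·A ⟨
  B *ᴹ (c *ₗ adj B)          ≈⟨ *ᴹ-*ₗ c B (adj B) ⟩
  c *ₗ (B *ᴹ adj B)          ≈⟨ *ₗ-cong c (*ᴹ-adj B) ⟩
  c *ₗ (det B *ₗ idℤ)        ≈⟨ *ₗ-assoc c (det B) idℤ ⟩
  (c * det B) *ₗ idℤ         ≈⟨ (λ i j → cong (_* idℤ i j) (ℤP.*-comm c (det B))) ⟩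
  (det B * c) *ₗ idℤ         ≈⟨ *ₗ-assoc (det B) c idℤ ⟨
  det B *ₗ (c *ₗ idℤ)        ∎)
  where
  open ≈ᴹ-Reasoning
  detB≢0 : det B ≢ + 0
  detB≢0 detB≡0 = c≢0 (ℤP.i^n≡0⇒i≡0 c n
    (trans (sym (det-*ᴹ-scalar A B AB≈cI)) (trans (cong (det A *_) detB≡0) (ℤP.*-zeroʳ (det A)))))
  c·adjB≈detB·A : (c *ₗ adj B) ≈ᴹ (det B *ₗ A)
  c·adjB≈detB·A = begin
    c *ₗ adj B               ≈⟨ *ₗidℤ-*ᴹ c (adj B) ⟨
    (c *ₗ idℤ) *ᴹ adj B      ≈⟨ *ᴹ-congʳ (adj B) AB≈cI ⟨
    (A *ᴹ B) *ᴹ adj B        ≈⟨ *ᴹ-assoc A B (adj B) ⟩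
    A *ᴹ (B *ᴹ adj B)        ≈⟨ *ᴹ-congˡ A (*ᴹ-adj B) ⟩
    A *ᴹ (det B *ₗ idℤ)      ≈⟨ *ᴹ-*ₗidℤ (det B) A ⟩
    det B *ₗ A               ∎

Unimodular⇒left-invertible : (U : Mat ℤ n) → Unimodular U → ∃ λ R → (R *ᴹ U) ≈ᴹ idℤ
Unimodular⇒left-invertible U unimodular = det U *ₗ adj U , (begin
  (det U *ₗ adj U) *ᴹ U         ≈⟨ *ₗ-*ᴹ (det U) (adj U) U ⟩
  det U *ₗ (adj U *ᴹ U)         ≈⟨ *ₗ-cong (det U) (*ᴹ-scalar-comm U (adj U) detU≢0 (*ᴹ-adj U)) ⟩
  det U *ₗ (det U *ₗ idℤ)       ≈⟨ *ₗ-assoc (det U) (det U) idℤ ⟩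
  (det U * det U) *ₗ idℤ        ≈⟨ (λ i j → trans (cong (_* idℤ i j) (square≡1 unimodular))
                                                   (ℤP.*-identityˡ (idℤ i j))) ⟩
  idℤ                           ∎)
  where
  open ≈ᴹ-Reasoning
  square≡1 : ∀ {u} → u ≡ + 1 ⊎ u ≡ - + 1 → u * u ≡ + 1
  square≡1 (inj₁ refl) = refl
  square≡1 (inj₂ refl) = refl
  unit-≢0 : ∀ {u} → u ≡ + 1 ⊎ u ≡ - + 1 → u ≢ + 0
  unit-≢0 (inj₁ refl) ()
  unit-≢0 (inj₂ refl) ()
  detU≢0 : det U ≢ + 0
  detU≢0 = unit-≢0 unimodular

module _ {m : ℕ} {M : Mat ℤ (suc m)} {d : Fin (suc m) → ℤ} (snf : IsSNF M d) where

  private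
    dₙ : ℤ
    dₙ = d (fromℕ m)

  invariantFactor-∣-last : (i : Fin (suc m)) → ∣ d i ∣ ℕD.∣ ∣ dₙ ∣
  invariantFactor-∣-last = FInd.>-weakInduction (λ i → ∣ d i ∣ ℕD.∣ ∣ dₙ ∣) ℕD.∣-refl
    (λ i → ℕD.∣-trans (proj₂ (proj₂ snf) (F.inject₁ i) (suc i) (cong suc (sym (FP.toℕ-inject₁ i)))))

  private
    e : Fin (suc m) → ℤ
    e i = + ℕD._∣_.quotient (invariantFactor-∣-last i)
    dᵢeᵢ≡dₙ : ∀ i → d i * e i ≡ dₙ
    dᵢeᵢ≡dₙ i = begin
      d i * e i                           ≡⟨ cong (_* e i) (ℤP.0≤i⇒+∣i∣≡i (proj₁ (proj₂ snf) i)) ⟨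
      + ∣ d i ∣ * e i                     ≡⟨ ℤP.pos-* ∣ d i ∣ _ ⟨
      + (∣ d i ∣ ℕ.* ℕD._∣_.quotient dᵢ∣dₙ) ≡⟨ cong +_ (ℕP.*-comm ∣ d i ∣ _) ⟩
      + (ℕD._∣_.quotient dᵢ∣dₙ ℕ.* ∣ d i ∣) ≡⟨ cong +_ (ℕD._∣_.equality dᵢ∣dₙ) ⟨
      + ∣ dₙ ∣                            ≡⟨ ℤP.0≤i⇒+∣i∣≡i (proj₁ (proj₂ snf) (fromℕ m)) ⟩
      dₙ                                  ∎
      where
      open ≡-Reasoning
      dᵢ∣dₙ : ∣ d i ∣ ℕD.∣ ∣ dₙ ∣
      dᵢ∣dₙ = invariantFactor-∣-last i
    diag-d*diag-e : (diag d *ᴹ diag e) ≈ᴹ (dₙ *ₗ idℤ)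
    diag-d*diag-e i j = trans (Σℤ-select (λ k → idℤ i k * d i * (idℤ k j * e k)) j off-diagonal)
                              (by-cases (i F.≟ j))
      where
      off-diagonal : ∀ k → k ≢ j → idℤ i k * d i * (idℤ k j * e k) ≡ + 0
      off-diagonal k k≢j = trans (cong (λ x → idℤ i k * d i * (x * e k)) (idℤ-off k≢j))
                                 (ℤP.*-zeroʳ (idℤ i k * d i))
      by-cases : Dec (i ≡ j) → idℤ i j * d i * (idℤ j j * e j) ≡ dₙ * idℤ i j
      by-cases (yes refl) = trans (cong₂ (λ x y → x * d i * (y * e i)) (idℤ-diag i) (idℤ-diag i))
        (trans (solve 2 (λ x y → con (+ 1) :* x :* (con (+ 1) :* y) := x :* y) refl (d i) (e i))
        (trans (dᵢeᵢ≡dₙ i) (sym (trans (cong (dₙ *_) (idℤ-diag i)) (ℤP.*-identityʳ dₙ)))))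
      by-cases (no i≢j)   = trans (cong (λ x → x * d i * (idℤ j j * e j)) (idℤ-off i≢j))
                                  (sym (trans (cong (dₙ *_) (idℤ-off i≢j)) (ℤP.*-zeroʳ dₙ)))

  -- The inverse of diag d scaled by dₙ is integral, hence so is dₙ M⁻¹ = V (dₙ D⁻¹) U.
  lastInvariantFactor-quasi-inverse : ∃ λ M′ → (M *ᴹ M′) ≈ᴹ (dₙ *ₗ idℤ)
  lastInvariantFactor-quasi-inverse = (V *ᴹ diag e) *ᴹ U , (begin
    M *ᴹ ((V *ᴹ diag e) *ᴹ U)     ≈⟨ *ᴹ-assoc M (V *ᴹ diag e) U ⟨
    (M *ᴹ (V *ᴹ diag e)) *ᴹ U     ≈⟨ *ᴹ-congʳ U (*ᴹ-assoc M V (diag e)) ⟨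
    ((M *ᴹ V) *ᴹ diag e) *ᴹ U     ≈⟨ *ᴹ-congʳ U (*ᴹ-congʳ (diag e) MV≈RD) ⟩
    ((R *ᴹ diag d) *ᴹ diag e) *ᴹ U ≈⟨ *ᴹ-congʳ U (*ᴹ-assoc R (diag d) (diag e)) ⟩
    (R *ᴹ (diag d *ᴹ diag e)) *ᴹ U ≈⟨ *ᴹ-congʳ U (*ᴹ-congˡ R diag-d*diag-e) ⟩
    (R *ᴹ (dₙ *ₗ idℤ)) *ᴹ U       ≈⟨ *ᴹ-congʳ U (*ᴹ-*ₗidℤ dₙ R) ⟩
    (dₙ *ₗ R) *ᴹ U                ≈⟨ *ₗ-*ᴹ dₙ R U ⟩
    dₙ *ₗ (R *ᴹ U)                ≈⟨ *ₗ-cong dₙ RU≈I ⟩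
    dₙ *ₗ idℤ                     ∎)
    where
    open ≈ᴹ-Reasoning
    U V R : Mat ℤ (suc m)
    U = proj₁ (proj₁ snf)
    V = proj₁ (proj₂ (proj₁ snf))
    UMV≈D : ((U *ᴹ M) *ᴹ V) ≈ᴹ diag d
    UMV≈D = proj₂ (proj₂ (proj₂ (proj₂ (proj₁ snf))))
    R = proj₁ (Unimodular⇒left-invertible U (proj₁ (proj₂ (proj₂ (proj₁ snf)))))
    RU≈I : (R *ᴹ U) ≈ᴹ idℤ
    RU≈I = proj₂ (Unimodular⇒left-invertible U (proj₁ (proj₂ (proj₂ (proj₁ snf)))))
    MV≈RD : (M *ᴹ V) ≈ᴹ (R *ᴹ diag d)
    MV≈RD = begin
      M *ᴹ V                ≈⟨ *ᴹ-identityˡ (M *ᴹ V) ⟨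
      idℤ *ᴹ (M *ᴹ V)       ≈⟨ *ᴹ-congʳ (M *ᴹ V) RU≈I ⟨
      (R *ᴹ U) *ᴹ (M *ᴹ V)  ≈⟨ *ᴹ-assoc R U (M *ᴹ V) ⟩
      R *ᴹ (U *ᴹ (M *ᴹ V))  ≈⟨ *ᴹ-congˡ R (*ᴹ-assoc U M V) ⟨
      R *ᴹ ((U *ᴹ M) *ᴹ V)  ≈⟨ *ᴹ-congˡ R UMV≈D ⟩
      R *ᴹ diag d           ∎

  cancel-by-lastInvariantFactor : (A Y : Mat ℤ (suc m)) (c : ℤ) → (A *ᴹ M) ≈ᴹ (c *ₗ Y) →
                           ∃ λ K → (d (fromℕ m) *ₗ A) ≈ᴹ (c *ₗ K)
  cancel-by-lastInvariantFactor A Y c AM≈cY = Y *ᴹ M′ , (begin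
    dₙ *ₗ A               ≈⟨ *ᴹ-*ₗidℤ dₙ A ⟨
    A *ᴹ (dₙ *ₗ idℤ)      ≈⟨ *ᴹ-congˡ A MM′≈dₙI ⟨
    A *ᴹ (M *ᴹ M′)        ≈⟨ *ᴹ-assoc A M M′ ⟨
    (A *ᴹ M) *ᴹ M′        ≈⟨ *ᴹ-congʳ M′ AM≈cY ⟩
    (c *ₗ Y) *ᴹ M′        ≈⟨ *ₗ-*ᴹ c Y M′ ⟩
    c *ₗ (Y *ᴹ M′)        ∎)
    where
    open ≈ᴹ-Reasoning
    M′ : Mat ℤ (suc m)
    M′ = proj₁ lastInvariantFactor-quasi-inverse
    MM′≈dₙI : (M *ᴹ M′) ≈ᴹ (dₙ *ₗ idℤ)
    MM′≈dₙI = proj₂ lastInvariantFactor-quasi-inverse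

-- Rational matrices with an integral multiple

ι : ℤ → ℚ
ι z = z ℚ./ 1

ι≃ : (a : ℤ) → ℚ.toℚᵘ (ι a) ℚᵘ.≃ mkℚᵘ a 0
ι≃ a = ℚP.toℚᵘ-fromℚᵘ (mkℚᵘ a 0)

ι-+ : (a b : ℤ) → ι (a + b) ≡ ι a ℚ.+ ι b
ι-+ a b = ℚP.toℚᵘ-injective (ℚᵘP.≃-trans (ι≃ (a + b)) (ℚᵘP.≃-trans
  (*≡* (solve 2 (λ a b → (a :+ b) :* con (+ 1) := (a :* con (+ 1) :+ b :* con (+ 1)) :* con (+ 1)) refl a b))
  (ℚᵘP.≃-sym (ℚᵘP.≃-trans (ℚP.toℚᵘ-homo-+ (ι a) (ι b)) (ℚᵘP.+-cong (ι≃ a) (ι≃ b))))))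

ι-* : (a b : ℤ) → ι (a * b) ≡ ι a ℚ.* ι b
ι-* a b = ℚP.toℚᵘ-injective (ℚᵘP.≃-trans (ι≃ (a * b)) (ℚᵘP.≃-trans
  (*≡* (solve 2 (λ a b → (a :* b) :* con (+ 1) := (a :* b) :* con (+ 1)) refl a b))
  (ℚᵘP.≃-sym (ℚᵘP.≃-trans (ℚP.toℚᵘ-homo-* (ι a) (ι b)) (ℚᵘP.*-cong (ι≃ a) (ι≃ b))))))

ι-injective : {a b : ℤ} → ι a ≡ ι b → a ≡ b
ι-injective {a} {b} ιa≡ιb
  with ℚᵘP.≃-trans (ℚᵘP.≃-sym (ι≃ a)) (ℚᵘP.≃-trans (ℚP.toℚᵘ-cong ιa≡ιb) (ι≃ b))
... | *≡* a*1≡b*1 = trans (sym (ℤP.*-identityʳ a)) (trans a*1≡b*1 (ℤP.*-identityʳ b))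

ι-Σ : (f : Fin n → ℤ) → ι (Σℤ f) ≡ Σℚ (λ i → ι (f i))
ι-Σ {zero}  f = refl
ι-Σ {suc n} f = trans (ι-+ (f zero) (Σℤ (f ∘ suc))) (cong (ι (f zero) ℚ.+_) (ι-Σ (f ∘ suc)))

Σℚ-cong : {f g : Fin n → ℚ} → (∀ i → f i ≡ g i) → Σℚ f ≡ Σℚ g
Σℚ-cong {zero}  h = refl
Σℚ-cong {suc n} h = cong₂ ℚ._+_ (h zero) (Σℚ-cong (h ∘ suc))

*-distribˡ-Σℚ : (s : ℚ) (f : Fin n → ℚ) → s ℚ.* Σℚ f ≡ Σℚ (λ i → s ℚ.* f i)
*-distribˡ-Σℚ s f = trans (cong (s ℚ.*_) (sumWith≡sum (Ring.semiring ℚP.+-*-ring) f))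
  (trans (ℚΣ.*-distribˡ-sum s f) (sym (sumWith≡sum (Ring.semiring ℚP.+-*-ring) (λ i → s ℚ.* f i))))

ι-Σ-scaled : (s : ℚ) (f : Fin n → ℤ) (g : Fin n → ℚ) → (∀ k → ι (f k) ≡ s ℚ.* g k) →
             ι (Σℤ f) ≡ s ℚ.* Σℚ g
ι-Σ-scaled s f g ιf≡sg = trans (ι-Σ f) (trans (Σℚ-cong ιf≡sg) (sym (*-distribˡ-Σℚ s g)))

*-cancelˡ-≢0ℚ : (s : ℚ) {p q : ℚ} → s ≢ 0ℚ → s ℚ.* p ≡ s ℚ.* q → p ≡ q
*-cancelˡ-≢0ℚ s {p} {q} s≢0 sp≡sq = trans (sym (s⁻¹s p)) (trans (cong (s⁻¹ ℚ.*_) sp≡sq) (s⁻¹s q))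
  where
  instance
    _ : ℚ.NonZero s
    _ = ℚ.≢-nonZero s≢0
  s⁻¹ : ℚ
  s⁻¹ = ℚ.1/ s
  s⁻¹s : ∀ x → s⁻¹ ℚ.* (s ℚ.* x) ≡ x
  s⁻¹s x = trans (sym (ℚP.*-assoc s⁻¹ s x)) (trans (cong (ℚ._* x) (ℚP.*-inverseˡ s)) (ℚP.*-identityˡ x))

module ScaledMatrix {n : ℕ} (c : ℤ) (Q : Mat ℚ n) (P : Mat ℤ n)
                    (cQ≡P : ∀ i j → ι c ℚ.* Q i j ≡ ι (P i j)) where

  private
    ιc : ℚ
    ιc = ι c

    ι-c*c* : (x : ℤ) → ι (c * c * x) ≡ (ιc ℚ.* ιc) ℚ.* ι x
    ι-c*c* x = trans (ι-* (c * c) x) (cong (ℚ._* ι x) (ι-* c c))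

    ι-P*P : ∀ i j k l → ι (P i j * P k l) ≡ (ιc ℚ.* ιc) ℚ.* (Q i j ℚ.* Q k l)
    ι-P*P i j k l = trans (ι-* (P i j) (P k l))
      (trans (sym (cong₂ ℚ._*_ (cQ≡P i j) (cQ≡P k l))) (ℚ*.interchange ιc (Q i j) ιc (Q k l)))

  scaled-orthogonal : Orthogonal Q → (transpose P *ᴹ P) ≈ᴹ ((c * c) *ₗ idℤ)
  scaled-orthogonal QᵀQ≡I i j = ι-injective (begin
    ι (Σℤ (λ k → P k i * P k j))                    ≡⟨ ι-Σ-scaled (ιc ℚ.* ιc) _ _ (λ k → ι-P*P k i k j) ⟩
    (ιc ℚ.* ιc) ℚ.* Σℚ (λ k → Q k i ℚ.* Q k j)      ≡⟨ cong ((ιc ℚ.* ιc) ℚ.*_) (QᵀQ≡I i j) ⟩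
    (ιc ℚ.* ιc) ℚ.* ι (idℤ i j)                     ≡⟨ ι-c*c* (idℤ i j) ⟨
    ι (c * c * idℤ i j)                             ∎)
    where open ≡-Reasoning

  scaled-conjugate : (A B : Mat ℤ n) → (∀ i j → (transpose Q *ᴿ (toℚᴹ A *ᴿ Q)) i j ≡ toℚᴹ B i j) →
                     (transpose P *ᴹ (A *ᴹ P)) ≈ᴹ ((c * c) *ₗ B)
  scaled-conjugate A B QᵀAQ≡B i j = ι-injective (begin
    ι (Σℤ (λ a → P a i * (A *ᴹ P) a j))              ≡⟨ ι-Σ-scaled (ιc ℚ.* ιc) _ _ outer ⟩
    (ιc ℚ.* ιc) ℚ.* Σℚ (λ a → Q a i ℚ.* AQ a)        ≡⟨ cong ((ιc ℚ.* ιc) ℚ.*_) (QᵀAQ≡B i j) ⟩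
    (ιc ℚ.* ιc) ℚ.* ι (B i j)                        ≡⟨ ι-c*c* (B i j) ⟨
    ι (c * c * B i j)                                ∎)
    where
    open ≡-Reasoning
    AQ : Fin n → ℚ
    AQ a = Σℚ (λ b → ι (A a b) ℚ.* Q b j)
    inner : ∀ a → ι ((A *ᴹ P) a j) ≡ ιc ℚ.* AQ a
    inner a = ι-Σ-scaled ιc _ _ (λ b → trans (ι-* (A a b) (P b j))
                (trans (cong (ι (A a b) ℚ.*_) (sym (cQ≡P b j))) (ℚ*.x∙yz≈y∙xz (ι (A a b)) ιc (Q b j))))
    outer : ∀ a → ι (P a i * (A *ᴹ P) a j) ≡ (ιc ℚ.* ιc) ℚ.* (Q a i ℚ.* AQ a)
    outer a = trans (ι-* (P a i) ((A *ᴹ P) a j))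
      (trans (cong₂ ℚ._*_ (sym (cQ≡P a i)) (inner a)) (ℚ*.interchange ιc (Q a i) ιc (AQ a)))

  scaled-fixesOnes : FixesOnes Q → ∀ i → (P ·ᵥ ones) i ≡ c
  scaled-fixesOnes Qe≡e i = ι-injective (begin
    ι (Σℤ (λ k → P i k * + 1))  ≡⟨ ι-Σ-scaled ιc _ _ (λ k → trans (cong ι (ℤP.*-identityʳ (P i k)))
                                                                 (sym (cQ≡P i k))) ⟩
    ιc ℚ.* Σℚ (λ k → Q i k)     ≡⟨ cong (ιc ℚ.*_) (Qe≡e i) ⟩
    ιc ℚ.* 1ℚ                   ≡⟨ ℚP.*-identityʳ ιc ⟩
    ιc                          ∎)
    where open ≡-Reasoning

module LevelMatrix {Q : Mat ℚ n} {ℓ : ℕ} (level : IsLevel Q ℓ) where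

  P : Mat ℤ n
  P i j = proj₁ (proj₁ (proj₂ level) i j)

  ℓQ≡P : ∀ i j → ι (+ ℓ) ℚ.* Q i j ≡ ι (P i j)
  ℓQ≡P i j = proj₂ (proj₁ (proj₂ level) i j)

  open ScaledMatrix (+ ℓ) Q P ℓQ≡P public

  ℓ≢0 : + ℓ ≢ + 0
  ℓ≢0 ℓ≡0 = ℕP.<⇒≢ (proj₁ level) (sym (ℤP.+-injective ℓ≡0))

  private instance
    ℓ-nonZero : ℕ.NonZero ℓ
    ℓ-nonZero = ℕ.>-nonZero (proj₁ level)

  -- The x with xQ integral are closed under subtracting multiples of ℓ,
  -- so x mod ℓ is one of them; minimality forces it to be 0.
  ∣-of-ScaledIntegral : (x : ℕ) → ScaledIntegral x Q → ℓ ℕD.∣ x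
  ∣-of-ScaledIntegral x xQ-integral with x ℕDM.% ℓ ℕP.≟ 0
  ... | yes r≡0 = ℕD.m%n≡0⇒n∣m x ℓ r≡0
  ... | no  r≢0 = ⊥-elim (ℕP.<⇒≱ (ℕDM.m%n<n x ℓ) (proj₂ (proj₂ level) r (ℕP.n≢0⇒n>0 r≢0) rQ-integral))
    where
    open ≡-Reasoning
    r : ℕ
    r = x ℕDM.% ℓ
    -q : ℤ
    -q = - + (x ℕDM./ ℓ)
    ι-+* : ∀ a b c → ι (a + b * c) ≡ ι a ℚ.+ ι b ℚ.* ι c
    ι-+* a b c = trans (ι-+ a (b * c)) (cong (ι a ℚ.+_) (ι-* b c))
    r≡x-qℓ : + r ≡ + x + -q * + ℓ
    r≡x-qℓ = begin
      + r                                ≡⟨ solve 3 (λ r q l → r := r :+ q :* l :+ :- q :* l)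
                                                    refl (+ r) (+ (x ℕDM./ ℓ)) (+ ℓ) ⟩
      + r + + (x ℕDM./ ℓ) * + ℓ + -q * + ℓ ≡⟨ cong (λ t → t + -q * + ℓ)
                                                    (trans (ℤP.pos-+ r _)
                                                           (cong (λ t → + r + t) (ℤP.pos-* (x ℕDM./ ℓ) ℓ))) ⟨
      + (r ℕ.+ x ℕDM./ ℓ ℕ.* ℓ) + -q * + ℓ ≡⟨ cong (λ t → + t + -q * + ℓ) (ℕDM.m≡m%n+[m/n]*n x ℓ) ⟨
      + x + -q * + ℓ                     ∎
    rQ-integral : ScaledIntegral r Q
    rQ-integral i j = z + -q * P i j , (begin
      ι (+ r) ℚ.* Q i j                                 ≡⟨ cong (λ t → ι t ℚ.* Q i j) r≡x-qℓ ⟩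
      ι (+ x + -q * + ℓ) ℚ.* Q i j                      ≡⟨ cong (ℚ._* Q i j) (ι-+* (+ x) -q (+ ℓ)) ⟩
      (ι (+ x) ℚ.+ ι -q ℚ.* ι (+ ℓ)) ℚ.* Q i j          ≡⟨ ℚP.*-distribʳ-+ (Q i j) (ι (+ x)) _ ⟩
      ι (+ x) ℚ.* Q i j ℚ.+ ι -q ℚ.* ι (+ ℓ) ℚ.* Q i j  ≡⟨ cong (ι (+ x) ℚ.* Q i j ℚ.+_)
                                                                  (ℚP.*-assoc (ι -q) _ _) ⟩
      ι (+ x) ℚ.* Q i j ℚ.+ ι -q ℚ.* (ι (+ ℓ) ℚ.* Q i j) ≡⟨ cong₂ (λ a b → a ℚ.+ ι -q ℚ.* b)
                                                                  (proj₂ (xQ-integral i j)) (ℓQ≡P i j) ⟩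
      ι z ℚ.+ ι -q ℚ.* ι (P i j)                        ≡⟨ ι-+* z -q (P i j) ⟨
      ι (z + -q * P i j)                                ∎)
      where
      z : ℤ
      z = proj₁ (xQ-integral i j)

  ∣-of-multiple : {x : ℤ} {K : Mat ℤ n} → + 0 ℤ.≤ x → (x *ₗ P) ≈ᴹ ((+ ℓ) *ₗ K) → ℓ ℕD.∣ ∣ x ∣
  ∣-of-multiple {x} {K} 0≤x xP≈ℓK = ∣-of-ScaledIntegral ∣ x ∣ (λ i j → K i j ,
    *-cancelˡ-≢0ℚ (ι (+ ℓ)) (ℓ≢0 ∘ ι-injective) (begin
      ι (+ ℓ) ℚ.* (ι (+ ∣ x ∣) ℚ.* Q i j) ≡⟨ cong (λ t → ι (+ ℓ) ℚ.* (ι t ℚ.* Q i j))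
                                                    (ℤP.0≤i⇒+∣i∣≡i 0≤x) ⟩
      ι (+ ℓ) ℚ.* (ι x ℚ.* Q i j)         ≡⟨ ℚ*.x∙yz≈y∙xz (ι (+ ℓ)) (ι x) (Q i j) ⟩
      ι x ℚ.* (ι (+ ℓ) ℚ.* Q i j)         ≡⟨ cong (ι x ℚ.*_) (ℓQ≡P i j) ⟩
      ι x ℚ.* ι (P i j)                   ≡⟨ ι-* x (P i j) ⟨
      ι (x * P i j)                       ≡⟨ cong ι (xP≈ℓK i j) ⟩
      ι (+ ℓ * K i j)                     ≡⟨ ι-* (+ ℓ) (K i j) ⟩
      ι (+ ℓ) ℚ.* ι (K i j)               ∎))
    where open ≡-Reasoning

module _ {m : ℕ} {Q : Mat ℚ (suc m)} {ℓ : ℕ} (level : IsLevel Q ℓ) where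
  open LevelMatrix level

  ∣-lastInvariantFactor : (M N : Mat ℤ (suc m)) → (P *ᴹ M) ≈ᴹ ((+ ℓ) *ₗ N) →
                          DividesLastInvFactor ℓ M
  ∣-lastInvariantFactor M N PM≈ℓN d snf = ∣-of-multiple (proj₁ (proj₂ snf) (fromℕ m))
    (proj₂ (cancel-by-lastInvariantFactor {M = M} snf P N (+ ℓ) PM≈ℓN))

  ∣-lastInvariantFactorᵀ : (M N : Mat ℤ (suc m)) → (transpose P *ᴹ M) ≈ᴹ ((+ ℓ) *ₗ N) →
                           DividesLastInvFactor ℓ M
  ∣-lastInvariantFactorᵀ M N PᵀM≈ℓN d snf = ∣-of-multiple (proj₁ (proj₂ snf) (fromℕ m))
    (λ i j → proj₂ (cancel-by-lastInvariantFactor {M = M} snf (transpose P) N (+ ℓ) PᵀM≈ℓN) j i)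

-- Walk matrices

conjugate-intertwine : (X Y A B : Mat ℤ n) {c : ℤ} → c ≢ + 0 → (X *ᴹ Y) ≈ᴹ (c *ₗ idℤ) →
                       (Y *ᴹ (A *ᴹ X)) ≈ᴹ (c *ₗ B) → (Y *ᴹ A) ≈ᴹ (B *ᴹ Y) × (A *ᴹ X) ≈ᴹ (X *ᴹ B)
conjugate-intertwine X Y A B {c} c≢0 XY≈cI YAX≈cB = *ₗ-cancel c c≢0 (begin
    c *ₗ (Y *ᴹ A)           ≈⟨ *ᴹ-*ₗidℤ c (Y *ᴹ A) ⟨
    (Y *ᴹ A) *ᴹ (c *ₗ idℤ)  ≈⟨ *ᴹ-congˡ (Y *ᴹ A) XY≈cI ⟨
    (Y *ᴹ A) *ᴹ (X *ᴹ Y)    ≈⟨ *ᴹ-assoc (Y *ᴹ A) X Y ⟨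
    ((Y *ᴹ A) *ᴹ X) *ᴹ Y    ≈⟨ *ᴹ-congʳ Y (≈ᴹ-trans (*ᴹ-assoc Y A X) YAX≈cB) ⟩
    (c *ₗ B) *ᴹ Y           ≈⟨ *ₗ-*ᴹ c B Y ⟩
    c *ₗ (B *ᴹ Y)           ∎)
  , *ₗ-cancel c c≢0 (begin
    c *ₗ (A *ᴹ X)           ≈⟨ *ₗidℤ-*ᴹ c (A *ᴹ X) ⟨
    (c *ₗ idℤ) *ᴹ (A *ᴹ X)  ≈⟨ *ᴹ-congʳ (A *ᴹ X) XY≈cI ⟨
    (X *ᴹ Y) *ᴹ (A *ᴹ X)    ≈⟨ *ᴹ-assoc X Y (A *ᴹ X) ⟩
    X *ᴹ (Y *ᴹ (A *ᴹ X))    ≈⟨ *ᴹ-congˡ X YAX≈cB ⟩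
    X *ᴹ (c *ₗ B)           ≈⟨ *ᴹ-*ₗ c X B ⟩
    c *ₗ (X *ᴹ B)           ∎)
  where open ≈ᴹ-Reasoning

ones-eigenvalue-transfer : (X Y : Mat ℤ n) {c : ℤ} → c ≢ + 0 → (Y *ᴹ X) ≈ᴹ ((c * c) *ₗ idℤ) →
                           (∀ i → (X ·ᵥ ones) i ≡ c) → ∀ i → (Y ·ᵥ ones) i ≡ c
ones-eigenvalue-transfer X Y {c} c≢0 YX≈c²I Xe≡c i = *-cancelˡ-≢0 c c≢0 (begin
  c * (Y ·ᵥ ones) i                    ≡⟨ ·ᵥ-*ₗ Y c ones i ⟨
  (Y ·ᵥ (λ k → c * + 1)) i             ≡⟨ ·ᵥ-cong {A = Y} ≈ᴹ-refl
                                                  (λ k → trans (ℤP.*-identityʳ c) (sym (Xe≡c k))) i ⟩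
  (Y ·ᵥ (X ·ᵥ ones)) i                 ≡⟨ ·ᵥ-*ᴹ Y X ones i ⟩
  ((Y *ᴹ X) ·ᵥ ones) i                 ≡⟨ ·ᵥ-cong YX≈c²I (λ _ → refl) i ⟩
  (((c * c) *ₗ idℤ) ·ᵥ ones) i          ≡⟨ Σℤ-cong (λ k → solve 2 (λ s x → s :* x :* con (+ 1) := x :* s)
                                                                  refl (c * c) (idℤ i k)) ⟩
  Σℤ (λ k → idℤ i k * (c * c))         ≡⟨ Σℤ-idℤ* (λ _ → c * c) i ⟩
  c * c                                ∎)
  where open ≡-Reasoning

walkMatrix : Mat ℤ n → Mat ℤ n
walkMatrix A i k = ((A ^ᴹ toℕ k) ·ᵥ ones) i

^ᴹ-intertwine : {X A B : Mat ℤ n} → (X *ᴹ A) ≈ᴹ (B *ᴹ X) → ∀ k → (X *ᴹ (A ^ᴹ k)) ≈ᴹ ((B ^ᴹ k) *ᴹ X)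
^ᴹ-intertwine {X = X}         XA≈BX zero    = ≈ᴹ-trans (*ᴹ-identityʳ X) (≈ᴹ-sym (*ᴹ-identityˡ X))
^ᴹ-intertwine {X = X} {A} {B} XA≈BX (suc k) = begin
  X *ᴹ (A *ᴹ (A ^ᴹ k))  ≈⟨ *ᴹ-assoc X A (A ^ᴹ k) ⟨
  (X *ᴹ A) *ᴹ (A ^ᴹ k)  ≈⟨ *ᴹ-congʳ (A ^ᴹ k) XA≈BX ⟩
  (B *ᴹ X) *ᴹ (A ^ᴹ k)  ≈⟨ *ᴹ-assoc B X (A ^ᴹ k) ⟩
  B *ᴹ (X *ᴹ (A ^ᴹ k))  ≈⟨ *ᴹ-congˡ B (^ᴹ-intertwine XA≈BX k) ⟩
  B *ᴹ ((B ^ᴹ k) *ᴹ X)  ≈⟨ *ᴹ-assoc B (B ^ᴹ k) X ⟨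
  (B *ᴹ (B ^ᴹ k)) *ᴹ X  ∎
  where open ≈ᴹ-Reasoning

walkMatrix-intertwine : (X A B : Mat ℤ n) {c : ℤ} → (X *ᴹ A) ≈ᴹ (B *ᴹ X) →
                        (∀ i → (X ·ᵥ ones) i ≡ c) → (X *ᴹ walkMatrix A) ≈ᴹ (c *ₗ walkMatrix B)
walkMatrix-intertwine X A B {c} XA≈BX Xe≡c i k = begin
  (X ·ᵥ ((A ^ᴹ toℕ k) ·ᵥ ones)) i       ≡⟨ ·ᵥ-*ᴹ X (A ^ᴹ toℕ k) ones i ⟩
  ((X *ᴹ (A ^ᴹ toℕ k)) ·ᵥ ones) i       ≡⟨ ·ᵥ-cong (^ᴹ-intertwine XA≈BX (toℕ k)) (λ _ → refl) i ⟩
  (((B ^ᴹ toℕ k) *ᴹ X) ·ᵥ ones) i       ≡⟨ ·ᵥ-*ᴹ (B ^ᴹ toℕ k) X ones i ⟨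
  ((B ^ᴹ toℕ k) ·ᵥ (X ·ᵥ ones)) i       ≡⟨ ·ᵥ-cong {A = B ^ᴹ toℕ k} ≈ᴹ-refl
                                                    (λ t → trans (Xe≡c t) (sym (ℤP.*-identityʳ c))) i ⟩
  ((B ^ᴹ toℕ k) ·ᵥ (λ t → c * + 1)) i   ≡⟨ ·ᵥ-*ₗ (B ^ᴹ toℕ k) c ones i ⟩
  c * ((B ^ᴹ toℕ k) ·ᵥ ones) i          ∎
  where open ≡-Reasoning

module ConjugateWalks {Q : Mat ℚ n} {ℓ : ℕ} (level : IsLevel Q ℓ) (orthogonal : Orthogonal Q)
                      (fixesOnes : FixesOnes Q) (A B : Mat ℤ n)
                      (conjugate : ∀ i j → (transpose Q *ᴿ (toℚᴹ A *ᴿ Q)) i j ≡ toℚᴹ B i j) where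
  open LevelMatrix level

  private
    ℓ²≢0 : + ℓ * + ℓ ≢ + 0
    ℓ²≢0 = *-≢0 ℓ≢0 ℓ≢0

    PᵀP≈ℓ²I : (transpose P *ᴹ P) ≈ᴹ ((+ ℓ * + ℓ) *ₗ idℤ)
    PᵀP≈ℓ²I = scaled-orthogonal orthogonal

    intertwined : (transpose P *ᴹ A) ≈ᴹ (B *ᴹ transpose P) × (A *ᴹ P) ≈ᴹ (P *ᴹ B)
    intertwined = conjugate-intertwine P (transpose P) A B ℓ²≢0
                    (*ᴹ-scalar-comm (transpose P) P ℓ²≢0 PᵀP≈ℓ²I) (scaled-conjugate A B conjugate)

    Pe≡ℓ : ∀ i → (P ·ᵥ ones) i ≡ + ℓ
    Pe≡ℓ = scaled-fixesOnes fixesOnes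

  Pᵀ-walk : (transpose P *ᴹ walkMatrix A) ≈ᴹ ((+ ℓ) *ₗ walkMatrix B)
  Pᵀ-walk = walkMatrix-intertwine (transpose P) A B (proj₁ intertwined)
                                  (ones-eigenvalue-transfer P (transpose P) ℓ≢0 PᵀP≈ℓ²I Pe≡ℓ)

  P-walk : (P *ᴹ walkMatrix B) ≈ᴹ ((+ ℓ) *ₗ walkMatrix A)
  P-walk = walkMatrix-intertwine P B A (≈ᴹ-sym (proj₂ intertwined)) Pe≡ℓ

-- (det X)² = (cⁿ)², so det X = ±cⁿ, and det Xᵀ · det M = cⁿ · det N.
det-≡±-of-scaled-orthogonal : (X M N : Mat ℤ n) {c : ℤ} → c ≢ + 0 →
                              (transpose X *ᴹ X) ≈ᴹ ((c * c) *ₗ idℤ) → (transpose X *ᴹ M) ≈ᴹ (c *ₗ N) →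
                              det N ≡ det M ⊎ det N ≡ - det M
det-≡±-of-scaled-orthogonal {n} X M N {c} c≢0 XᵀX≈c²I XᵀM≈cN =
  by-cases (i*i≡j*j⇒i≡±j (det X) (c ^ n) detX²≡cⁿ²)
  where
  cⁿ≢0 : c ^ n ≢ + 0
  cⁿ≢0 = c≢0 ∘ ℤP.i^n≡0⇒i≡0 c n
  detX²≡cⁿ² : det X * det X ≡ c ^ n * c ^ n
  detX²≡cⁿ² = trans (cong (_* det X) (sym (det-transpose X)))
                    (trans (det-*ᴹ-scalar (transpose X) X XᵀX≈c²I) (^-distrib-* c c n))
  cⁿdetN≡detXdetM : c ^ n * det N ≡ det X * det M
  cⁿdetN≡detXdetM = trans (sym (det-*ₗ c N)) (trans (det-cong (≈ᴹ-sym XᵀM≈cN))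
                      (trans (det-*ᴹ (transpose X) M) (cong (_* det M) (det-transpose X))))
  by-cases : det X ≡ c ^ n ⊎ det X ≡ - c ^ n → det N ≡ det M ⊎ det N ≡ - det M
  by-cases (inj₁ detX≡cⁿ)  = inj₁ (*-cancelˡ-≢0 (c ^ n) cⁿ≢0
    (trans cⁿdetN≡detXdetM (cong (_* det M) detX≡cⁿ)))
  by-cases (inj₂ detX≡-cⁿ) = inj₂ (*-cancelˡ-≢0 (c ^ n) cⁿ≢0
    (trans cⁿdetN≡detXdetM (trans (cong (_* det M) detX≡-cⁿ)
      (trans (sym (ℤP.neg-distribˡ-* (c ^ n) (det M))) (ℤP.neg-distribʳ-* (c ^ n) (det M))))))

InF-resp-±det : (D C : OrientedGraph n) → det (W C) ≡ det (W D) ⊎ det (W C) ≡ - det (W D) →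
                InF D → InF C
InF-resp-±det {n} D C (inj₁ detC≡detD)  (k , detD≡2ᵗk , odd , squareFree) =
  k , trans detC≡detD detD≡2ᵗk , odd , squareFree
InF-resp-±det {n} D C (inj₂ detC≡-detD) (k , detD≡2ᵗk , odd , squareFree) =
  - k ,
  trans detC≡-detD (trans (cong -_ detD≡2ᵗk) (ℤP.neg-distribʳ-* (+ (2 ℕ.^ ⌊ n /2⌋)) k)) ,
  odd ∘ subst (2 ℕD.∣_) (ℤP.∣-i∣≡∣i∣ k) ,
  (λ j j²∣k → squareFree j (subst (j ℕ.* j ℕD.∣_) (ℤP.∣-i∣≡∣i∣ k) j²∣k))

lemma7 : (m : ℕ) (D C : OrientedGraph (suc m)) (Q : Mat ℚ (suc m)) (ℓ : ℕ)
         → InF D → Orthogonal Q → FixesOnes Q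
         → (∀ i j → (transpose Q *ᴿ (toℚᴹ (S D) *ᴿ Q)) i j ≡ toℚᴹ (S C) i j)
         → IsLevel Q ℓ
         → DividesLastInvFactor ℓ (W D) × DividesLastInvFactor ℓ (W C) × InF C
lemma7 m D C Q ℓ D∈F orthogonal fixesOnes conjugate level =
  ∣-lastInvariantFactorᵀ level (W D) (W C) Pᵀ-walk ,
  ∣-lastInvariantFactor level (W C) (W D) P-walk ,
  InF-resp-±det D C (det-≡±-of-scaled-orthogonal P (W D) (W C) ℓ≢0 (scaled-orthogonal orthogonal) Pᵀ-walk) D∈F
  where
  open LevelMatrix level
  open ConjugateWalks level orthogonal fixesOnes (S D) (S C) conjugate
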